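{- Let $k\geq 2$ be an integer. For $n\geq 0$ let $ud(n)$, $dd(n)$, $uu(n)$, $du(n)$ denote, respectively, the numbers of up-down, down-down, up-up and down-up permutations of length $n$ that avoid both $1\mbox{ - }3\mbox{ - }2$ and $1\mbox{ - }2\mbox{ - }\cdots\mbox{ - }k$, and let $UD(x)=\sum_{n\geq0}ud(n)x^n$, $DD(x)=\sum_{n\ge0}dd(n)x^n$, $UU(x)=\sum_{n\ge0}uu(n)x^n$, $DU(x)=\sum_{n\ge0}du(n)x^n$. Then, writing $U_r$ for $U_r\!\left(\frac{1}{2x}\right)$, (1) $UD(x)=\dfrac{xU_{k-3}}{U_{k-1}}$; (2) $DD(x)=\dfrac{x^{k-1}+U_{k-3}}{U_{k-1}}$; (3) $UU(x)=\dfrac{U_{k-3}}{U_{k-1}}$; (4) $DU(x)=\dfrac{x^{k-1}+U_{k-3}}{xU_{k-1}}-x$.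
   Context: A permutation of length $n$ is a word $\pi_1\cdots\pi_n$ containing each of $1,\dots,n$ exactly once. For a permutation $\tau$ of length $m$, the classical pattern $\tau$ (written with dashes between letters, e.g. $1\mbox{ - }3\mbox{ - }2$, $1\mbox{ - }2\mbox{ - }\cdots\mbox{ - }k$) occurs in $\pi$ at indices $i_1<\dots<i_m$ if $\pi_{i_1}\cdots\pi_{i_m}$ is order-isomorphic to $\tau$; $\pi$ avoids $\tau$ if there is no occurrence. Thus $1\mbox{ - }3\mbox{ - }2$ is the classical pattern $132$ and $1\mbox{ - }2\mbox{ - }\cdots\mbox{ - }k$ is an increasing subsequence of length $k$. For $n\ge2$: up-down permutations satisfy $\pi_1<\pi_2>\pi_3<\cdots$ and have odd length; up-up permutations satisfy $\pi_1<\pi_2>\pi_3<\cdots$ and have even length; down-up permutations satisfy $\pi_1>\pi_2<\pi_3>\cdots$ and have odd length; down-down permutations satisfy $\pi_1>\pi_2<\pi_3>\cdots$ and have even length. For $n=0,1$ none of these four classes has any element. $U_r$ denotes the Chebyshev polynomial of the second kind, $U_r(\cos\theta)=\frac{\sin((r+1)\theta)}{\sin\theta}$, so $U_{ -1}(t)=0$, $U_0(t)=1$, $U_1(t)=2t$, $U_r(t)=2tU_{r-1}(t)-U_{r-2}(t)$. -}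

module Defs where

open import Data.Bool using (Bool; true; false; _∧_; _∨_; not; _xor_; if_then_else_)
open import Data.Nat as ℕ using (ℕ; zero; suc; _∸_; _≡ᵇ_; _<ᵇ_; _≤ᵇ_)
open import Data.Integer as ℤ using (ℤ)
open import Data.List using (List; []; _∷_; map; concatMap; _++_; length; upTo; zip; filterᵇ)
open import Data.Bool.ListAction using (all; any)
open import Data.Product using (_,_)
open import Relation.Binary.PropositionalEquality using (_≡_)
open import Data.Rational as ℚ using (ℚ; 0ℚ; 1ℚ; ½; _+_; _*_)

words : ℕ → ℕ → List (List ℕ)
words zero    m = [] ∷ []
words (suc n) m = concatMap (λ v → map (v ∷_) (words n m)) (map suc (upTo m))

count : ℕ → List ℕ → ℕ
count v w = length (filterᵇ (λ x → x ≡ᵇ v) w)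

perms : ℕ → List (List ℕ)
perms n = filterᵇ (λ w → all (λ v → count v w ≡ᵇ 1) (map suc (upTo n))) (words n n)

subseqs : {A : Set} → ℕ → List A → List (List A)
subseqs zero    _        = [] ∷ []
subseqs (suc m) []       = []
subseqs (suc m) (a ∷ as) = map (a ∷_) (subseqs m as) ++ subseqs (suc m) as

beq : Bool → Bool → Bool
beq a b = not (a xor b)

orderIso : List ℕ → List ℕ → Bool
orderIso []       []       = true
orderIso (a ∷ as) (b ∷ bs) =
  all (λ { (x , y) → beq (a <ᵇ x) (b <ᵇ y) ∧ beq (x <ᵇ a) (y <ᵇ b) }) (zip as bs)
  ∧ orderIso as bs
orderIso _        _        = false

contains : List ℕ → List ℕ → Bool
contains τ π = any (orderIso τ) (subseqs (length τ) π)

avoids : List ℕ → List ℕ → Bool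
avoids τ π = not (contains τ π)

p132 : List ℕ
p132 = 1 ∷ 3 ∷ 2 ∷ []

inc : ℕ → List ℕ
inc k = map suc (upTo k)

altFrom : Bool → List ℕ → Bool
altFrom up (a ∷ b ∷ rest) = (if up then a <ᵇ b else b <ᵇ a) ∧ altFrom (not up) (b ∷ rest)
altFrom up _              = true

isEven : ℕ → Bool
isEven zero          = true
isEven (suc zero)    = false
isEven (suc (suc n)) = isEven n

isUpDown isUpUp isDownUp isDownDown : List ℕ → Bool
isUpDown   w = (2 ≤ᵇ length w) ∧ not (isEven (length w)) ∧ altFrom true  w
isUpUp     w = (2 ≤ᵇ length w) ∧ isEven (length w)       ∧ altFrom true  w
isDownUp   w = (2 ≤ᵇ length w) ∧ not (isEven (length w)) ∧ altFrom false w
isDownDown w = (2 ≤ᵇ length w) ∧ isEven (length w)       ∧ altFrom false w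

countAv : (List ℕ → Bool) → ℕ → ℕ → ℕ
countAv cls k n = length (filterᵇ (λ w → cls w ∧ avoids p132 w ∧ avoids (inc k) w) (perms n))

ud dd uu du : ℕ → ℕ → ℕ
ud k = countAv isUpDown k
dd k = countAv isDownDown k
uu k = countAv isUpUp k
du k = countAv isDownUp k

Series : Set
Series = ℕ → ℚ

fromCounts : (ℕ → ℕ) → Series
fromCounts f n = ℚ._/_ (ℤ.+ f n) 1

sumTo : ℕ → (ℕ → ℚ) → ℚ
sumTo zero    f = f 0
sumTo (suc n) f = sumTo n f + f (suc n)

_⊕_ : Series → Series → Series
(f ⊕ g) n = f n + g n

_⊛_ : Series → Series → Series
(f ⊛ g) n = sumTo n (λ i → f i * g (n ∸ i))

infixl 6 _⊕_
infixl 7 _⊛_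

mono : ℕ → Series
mono d i = if i ≡ᵇ d then 1ℚ else 0ℚ

_≈ₛ_ : Series → Series → Set
f ≈ₛ g = ∀ n → f n ≡ g n

infix 4 _≈ₛ_

-- Chebyshev polynomials of the second kind, with integer coefficients.
-- Ucoef m j = coefficient of t^j in U_{m-1}(t)   (so m = 0 gives U_{-1} = 0)

Ucoef : ℕ → ℕ → ℤ
Ucoef zero          j       = ℤ.0ℤ
Ucoef (suc zero)    zero    = ℤ.1ℤ
Ucoef (suc zero)    (suc j) = ℤ.0ℤ
Ucoef (suc (suc m)) zero    = ℤ.- Ucoef m zero
Ucoef (suc (suc m)) (suc j) = ℤ.+ 2 ℤ.* Ucoef (suc m) j ℤ.- Ucoef m (suc j)

_^ℚ_ : ℚ → ℕ → ℚ
q ^ℚ zero  = 1ℚ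
q ^ℚ suc n = q * (q ^ℚ n)

-- xPowU N r : the series  x^N · U_r(1/(2x))  (a polynomial in x when N ≥ r),
-- with r given as m = r + 1.  Coefficient of x^i is  Ucoef m (N-i) · (1/2)^(N-i).
xPowU : ℕ → ℕ → Series
xPowU N m i = if i ≤ᵇ N then ℚ._/_ (Ucoef m (N ∸ i)) 1 * (½ ^ℚ (N ∸ i)) else 0ℚ

-- Every 132-avoiding permutation of length n+1 factors uniquely as (α + b) (n+1) β, where α and β
-- are 132-avoiding permutations of lengths a and b with a + b = n: an entry left of the maximum that
-- is smaller than an entry right of it would form a 132 with the maximum.  Such a word avoids
-- 1-2-…-k iff α avoids 1-2-…-(k-1) and β avoids 1-2-…-k, and since the maximum is a peak its
-- alternation type is determined by those of α and β.  This turns the four counts into convolutions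
-- of the series E_k, F_k, G_k of 132-avoiders that are up-down or of length one, down-down or empty,
-- and up-up or empty.  With P_k = x^(k-1) U_(k-1)(1/(2x)), which satisfies P_(k+1) + x² P_(k-1) = P_k,
-- induction on k gives E_k P_k = x P_(k-1) and F_k P_k = P_(k-1) + x^(2(k-1)), and the four identities
-- follow.

module Submission where

module Lists where

  open import Data.Bool using (Bool; true; false; _∧_; if_then_else_; T?)
  open import Data.Nat using (suc; _+_; _*_; _≤_; z≤n; s≤s)
  open import Data.Nat.Properties using (+-suc; ≤-antisym)
  open import Data.List using (List; []; _∷_; map; concatMap; _++_; length; filterᵇ)
  open import Data.List.Properties using (length-++; filter-++)
  open import Data.List.Membership.Propositional using (_∈_; find; lose)
  open import Data.List.Membership.Propositional.Properties using (∈-∃++; ∈-map⁻; ∈-++⁺ˡ; ∈-++⁺ʳ; ∈-concatMap⁺; ∈-concatMap⁻)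
  open import Data.List.Relation.Unary.Any using (here; there)
  import Data.List.Relation.Unary.All as All
  open import Data.List.Relation.Unary.AllPairs using ([]; _∷_)
  open import Data.List.Relation.Unary.All.Properties using (All¬⇒¬Any; ¬Any⇒All¬)
  open import Data.List.Relation.Unary.Unique.Propositional using (Unique)
  import Data.List.Relation.Unary.Unique.Propositional.Properties as Unique
  open import Data.Product using (Σ; _×_; _,_)
  open import Data.Empty using (⊥; ⊥-elim)
  open import Relation.Binary.PropositionalEquality using (_≡_; refl; sym; trans; cong; cong₂; subst; _≢_)

  private
    variable
      A B C : Set

  filterᵇ-∷ : (p : A → Bool) (x : A) (xs : List A) →
    filterᵇ p (x ∷ xs) ≡ (if p x then x ∷ filterᵇ p xs else filterᵇ p xs)
  filterᵇ-∷ p x xs with p x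
  ... | true = refl
  ... | false = refl

  ∈-filterᵇ⁺ : (p : A → Bool) {x : A} {xs : List A} → x ∈ xs → p x ≡ true → x ∈ filterᵇ p xs
  ∈-filterᵇ⁺ p {x} {y ∷ xs} (here refl) px rewrite filterᵇ-∷ p y xs | px = here refl
  ∈-filterᵇ⁺ p {x} {y ∷ xs} (there m) px rewrite filterᵇ-∷ p y xs with p y
  ... | true = there (∈-filterᵇ⁺ p m px)
  ... | false = ∈-filterᵇ⁺ p m px

  ∈-filterᵇ⁻ : (p : A → Bool) {x : A} (xs : List A) → x ∈ filterᵇ p xs → x ∈ xs × p x ≡ true
  ∈-filterᵇ⁻ p (y ∷ xs) m rewrite filterᵇ-∷ p y xs with p y in eq
  ∈-filterᵇ⁻ p (y ∷ xs) (here refl) | true = here refl , eq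
  ∈-filterᵇ⁻ p (y ∷ xs) (there m) | true = let (m′ , px) = ∈-filterᵇ⁻ p xs m in there m′ , px
  ... | false = let (m′ , px) = ∈-filterᵇ⁻ p xs m in there m′ , px

  Unique-filterᵇ : (p : A → Bool) {xs : List A} → Unique xs → Unique (filterᵇ p xs)
  Unique-filterᵇ p = Unique.filter⁺ (λ x → T? (p x))

  filterᵇ-cong : (p q : A → Bool) (xs : List A) → (∀ {x} → x ∈ xs → p x ≡ q x) → filterᵇ p xs ≡ filterᵇ q xs
  filterᵇ-cong p q [] h = refl
  filterᵇ-cong p q (y ∷ xs) h rewrite filterᵇ-∷ p y xs | filterᵇ-∷ q y xs | h (here refl)
    | filterᵇ-cong p q xs (λ m → h (there m)) = refl

  filterᵇ-∧ : (p q : A → Bool) (xs : List A) → filterᵇ (λ x → p x ∧ q x) xs ≡ filterᵇ q (filterᵇ p xs)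
  filterᵇ-∧ p q [] = refl
  filterᵇ-∧ p q (x ∷ xs) rewrite filterᵇ-∷ (λ x → p x ∧ q x) x xs | filterᵇ-∷ p x xs with p x
  ... | false = filterᵇ-∧ p q xs
  ... | true rewrite filterᵇ-∷ q x (filterᵇ p xs) with q x
  ... | true = cong (x ∷_) (filterᵇ-∧ p q xs)
  ... | false = filterᵇ-∧ p q xs

  length-filterᵇ-false : (xs : List A) → length (filterᵇ (λ _ → false) xs) ≡ 0
  length-filterᵇ-false [] = refl
  length-filterᵇ-false (x ∷ xs) = length-filterᵇ-false xs

  length-filterᵇ-++ : (p : A → Bool) (xs ys : List A) →
    length (filterᵇ p (xs ++ ys)) ≡ length (filterᵇ p xs) + length (filterᵇ p ys)
  length-filterᵇ-++ p xs ys = trans (cong length (filter-++ _ xs ys)) (length-++ (filterᵇ p xs))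

  ∈-remove : ∀ {z x : A} (ys zs : List A) → z ∈ ys ++ x ∷ zs → z ≢ x → z ∈ ys ++ zs
  ∈-remove [] zs (here refl) z≢x = ⊥-elim (z≢x refl)
  ∈-remove [] zs (there m) z≢x = m
  ∈-remove (y ∷ ys) zs (here refl) z≢x = here refl
  ∈-remove (y ∷ ys) zs (there m) z≢x = there (∈-remove ys zs m z≢x)

  ⊆⇒length≤ : (xs ys : List A) → Unique xs → (∀ {z} → z ∈ xs → z ∈ ys) → length xs ≤ length ys
  ⊆⇒length≤ [] ys u xs⊆ys = z≤n
  ⊆⇒length≤ (x ∷ xs) ys (x∉xs ∷ u) xs⊆ys with ∈-∃++ (xs⊆ys (here refl))
  ... | ys₁ , ys₂ , refl = subst (suc (length xs) ≤_) (sym length-split) (s≤s rest)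
    where
    rest : length xs ≤ length (ys₁ ++ ys₂)
    rest = ⊆⇒length≤ xs (ys₁ ++ ys₂) u
      (λ m → ∈-remove ys₁ ys₂ (xs⊆ys (there m)) (λ { refl → All¬⇒¬Any x∉xs m }))
    length-split : length (ys₁ ++ x ∷ ys₂) ≡ suc (length (ys₁ ++ ys₂))
    length-split = trans (length-++ ys₁) (trans (+-suc (length ys₁) (length ys₂)) (cong suc (sym (length-++ ys₁))))

  length-filterᵇ-≡ : (p : A → Bool) (xs ys : List A) → Unique xs → Unique ys →
    (∀ {z} → z ∈ xs → z ∈ ys) → (∀ {z} → z ∈ ys → z ∈ xs) →
    length (filterᵇ p xs) ≡ length (filterᵇ p ys)
  length-filterᵇ-≡ p xs ys u v xs⊆ys ys⊆xs = ≤-antisym (mono xs ys u xs⊆ys) (mono ys xs v ys⊆xs)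
    where
    mono : (xs ys : List _) → Unique xs → (∀ {z} → z ∈ xs → z ∈ ys) → length (filterᵇ p xs) ≤ length (filterᵇ p ys)
    mono xs ys u ⊆ = ⊆⇒length≤ (filterᵇ p xs) (filterᵇ p ys) (Unique-filterᵇ p u)
      (λ m → let (m′ , pz) = ∈-filterᵇ⁻ p xs m in ∈-filterᵇ⁺ p (⊆ m′) pz)

  Unique-++⁻ : ∀ (xs ys : List A) → Unique (xs ++ ys) → Unique xs × Unique ys × (∀ {z} → z ∈ xs → z ∈ ys → ⊥)
  Unique-++⁻ [] ys u = [] , u , λ ()
  Unique-++⁻ (x ∷ xs) ys (x∉ ∷ u) with Unique-++⁻ xs ys u
  ... | uxs , uys , disjoint = All.tabulate (λ m → All.lookup x∉ (∈-++⁺ˡ m)) ∷ uxs , uys ,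
      λ { (here refl) m₂ → All¬⇒¬Any x∉ (∈-++⁺ʳ xs m₂) ; (there m₁) m₂ → disjoint m₁ m₂ }

  ∈-concatMap⁻′ : (f : A → List B) (xs : List A) {z : B} → z ∈ concatMap f xs → Σ A (λ x → x ∈ xs × z ∈ f x)
  ∈-concatMap⁻′ f xs m = find (∈-concatMap⁻ f m)

  ∈-concatMap⁺′ : (f : A → List B) {xs : List A} {x : A} {z : B} → x ∈ xs → z ∈ f x → z ∈ concatMap f xs
  ∈-concatMap⁺′ f x∈xs z∈fx = ∈-concatMap⁺ f (lose x∈xs z∈fx)

  Unique-map : (f : A → B) (xs : List A) → Unique xs →
    (∀ {x y} → x ∈ xs → y ∈ xs → f x ≡ f y → x ≡ y) → Unique (map f xs)
  Unique-map f [] u inj = []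
  Unique-map f (x ∷ xs) (x∉xs ∷ u) inj =
    ¬Any⇒All¬ (map f xs) (λ m → let (y , y∈xs , fx≡fy) = ∈-map⁻ f m in
      All¬⇒¬Any x∉xs (subst (_∈ xs) (sym (inj (here refl) (there y∈xs) fx≡fy)) y∈xs))
    ∷ Unique-map f xs u (λ m n → inj (there m) (there n))

  Unique-concatMap : (f : A → List B) (xs : List A) → Unique xs → (∀ {x} → x ∈ xs → Unique (f x)) →
    (∀ {x y z} → x ∈ xs → y ∈ xs → z ∈ f x → z ∈ f y → x ≡ y) → Unique (concatMap f xs)
  Unique-concatMap f [] u h d = []
  Unique-concatMap f (x ∷ xs) (x∉xs ∷ u) h d =
    Unique.++⁺ (h (here refl)) (Unique-concatMap f xs u (λ m → h (there m)) (λ m n → d (there m) (there n)))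
      (λ (m₁ , m₂) → let (y , y∈xs , z∈fy) = ∈-concatMap⁻′ f xs m₂ in
        All¬⇒¬Any x∉xs (subst (_∈ xs) (sym (d (here refl) (there y∈xs) m₁ z∈fy)) y∈xs))

  length-filterᵇ-map : (p : B → Bool) (q : A → Bool) (f : A → B) (xs : List A) → (∀ {x} → x ∈ xs → p (f x) ≡ q x) →
    length (filterᵇ p (map f xs)) ≡ length (filterᵇ q xs)
  length-filterᵇ-map p q f [] h = refl
  length-filterᵇ-map p q f (x ∷ xs) h rewrite filterᵇ-∷ p (f x) (map f xs) | filterᵇ-∷ q x xs | h (here refl) with q x
  ... | true = cong suc (length-filterᵇ-map p q f xs (λ m → h (there m)))
  ... | false = length-filterᵇ-map p q f xs (λ m → h (there m))

  length-filterᵇ-product : (r : C → Bool) (p : A → Bool) (q : B → Bool) (f : A → B → C) (xs : List A) (ys : List B) →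
    (∀ {x y} → x ∈ xs → y ∈ ys → r (f x y) ≡ p x ∧ q y) →
    length (filterᵇ r (concatMap (λ x → map (f x) ys) xs)) ≡ length (filterᵇ p xs) * length (filterᵇ q ys)
  length-filterᵇ-product r p q f [] ys h = refl
  length-filterᵇ-product r p q f (x ∷ xs) ys h
    rewrite length-filterᵇ-++ r (map (f x) ys) (concatMap (λ x → map (f x) ys) xs) | filterᵇ-∷ p x xs
    with p x in px
  ... | true = cong₂ _+_ (length-filterᵇ-map r q (f x) ys (λ m → trans (h (here refl) m) (cong (_∧ q _) px)))
                         (length-filterᵇ-product r p q f xs ys (λ m n → h (there m) n))
  ... | false = cong₂ _+_ (trans (length-filterᵇ-map r (λ _ → false) (f x) ys
                                   (λ m → trans (h (here refl) m) (cong (_∧ q _) px)))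
                                 (length-filterᵇ-false ys))
                          (length-filterᵇ-product r p q f xs ys (λ m n → h (there m) n))

module BooleanReflection where

  open import Data.Bool using (Bool; true; false; _∧_; _∨_; not; T)
  open import Data.Bool.ListAction using (all; any)
  open import Data.Nat using (suc; s≤s; _<_; _≤_; _≡ᵇ_; _<ᵇ_; _≤ᵇ_)
  open import Data.Nat.Properties using (≡ᵇ⇒≡; ≡⇒≡ᵇ; <ᵇ⇒<; <⇒<ᵇ; ≤⇒≤ᵇ; ≤⇒≯)
  open import Data.List using (List; []; _∷_)
  open import Data.List.Membership.Propositional using (_∈_)
  open import Data.List.Relation.Unary.Any using (here; there)
  open import Data.Product using (Σ; _×_; _,_)
  open import Data.Unit using (tt)
  open import Data.Empty using (⊥-elim)
  open import Relation.Nullary using (¬_)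
  open import Relation.Binary.PropositionalEquality using (_≡_; refl; _≢_)

  private
    variable
      A : Set

  T⇒≡ : ∀ {b} → T b → b ≡ true
  T⇒≡ {true} _ = refl

  ≡⇒T : ∀ {b} → b ≡ true → T b
  ≡⇒T refl = tt

  true≢false : {X : Set} → true ≡ false → X
  true≢false ()

  not-∨ : ∀ b c → not (b ∨ c) ≡ not b ∧ not c
  not-∨ true c = refl
  not-∨ false c = refl

  ∧-true⁻ˡ : ∀ {b c} → b ∧ c ≡ true → b ≡ true
  ∧-true⁻ˡ {true} e = refl

  ∧-true⁻ʳ : ∀ {b c} → b ∧ c ≡ true → c ≡ true
  ∧-true⁻ʳ {true} e = e

  ≡ᵇ-true⁻ : ∀ {m n} → (m ≡ᵇ n) ≡ true → m ≡ n
  ≡ᵇ-true⁻ {m} {n} e = ≡ᵇ⇒≡ m n (≡⇒T e)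

  ≡ᵇ-refl : ∀ m → (m ≡ᵇ m) ≡ true
  ≡ᵇ-refl m = T⇒≡ (≡⇒≡ᵇ m m refl)

  ≡ᵇ-false : ∀ {m n} → m ≢ n → (m ≡ᵇ n) ≡ false
  ≡ᵇ-false {m} {n} m≢n with m ≡ᵇ n in eq
  ... | true = ⊥-elim (m≢n (≡ᵇ-true⁻ eq))
  ... | false = refl

  <ᵇ-true : ∀ {m n} → m < n → (m <ᵇ n) ≡ true
  <ᵇ-true m<n = T⇒≡ (<⇒<ᵇ m<n)

  <ᵇ-true⁻ : ∀ {m n} → (m <ᵇ n) ≡ true → m < n
  <ᵇ-true⁻ {m} {n} e = <ᵇ⇒< m n (≡⇒T e)

  <ᵇ-false : ∀ {m n} → ¬ m < n → (m <ᵇ n) ≡ false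
  <ᵇ-false {m} {n} m≮n with m <ᵇ n in eq
  ... | true = ⊥-elim (m≮n (<ᵇ-true⁻ eq))
  ... | false = refl

  ≤ᵇ-true : ∀ {m n} → m ≤ n → (m ≤ᵇ n) ≡ true
  ≤ᵇ-true m≤n = T⇒≡ (≤⇒≤ᵇ m≤n)

  ≤ᵇ-false : ∀ {m n} → n < m → (m ≤ᵇ n) ≡ false
  ≤ᵇ-false {suc m} {n} (s≤s n≤m) = <ᵇ-false {m} {n} (≤⇒≯ n≤m)

  all-true⁺ : (p : A → Bool) (xs : List A) → (∀ {x} → x ∈ xs → p x ≡ true) → all p xs ≡ true
  all-true⁺ p [] h = refl
  all-true⁺ p (x ∷ xs) h rewrite h (here refl) = all-true⁺ p xs (λ m → h (there m))

  all-true⁻ : (p : A → Bool) (xs : List A) → all p xs ≡ true → ∀ {x} → x ∈ xs → p x ≡ true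
  all-true⁻ p (y ∷ xs) e m with p y in py
  all-true⁻ p (y ∷ xs) e (here refl) | true = py
  all-true⁻ p (y ∷ xs) e (there m) | true = all-true⁻ p xs e m

  any-true⁺ : (p : A → Bool) (xs : List A) {x : A} → x ∈ xs → p x ≡ true → any p xs ≡ true
  any-true⁺ p (y ∷ xs) (here refl) px rewrite px = refl
  any-true⁺ p (y ∷ xs) (there m) px with p y
  ... | true = refl
  ... | false = any-true⁺ p xs m px

  any-true⁻ : (p : A → Bool) (xs : List A) → any p xs ≡ true → Σ A λ x → x ∈ xs × p x ≡ true
  any-true⁻ p (x ∷ xs) e with p x in px
  ... | true = x , here refl , px
  ... | false = let (y , m , py) = any-true⁻ p xs e in y , there m , py

module Permutations where

  open import Defs
  open Lists
  open BooleanReflection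
  open import Data.Bool using (Bool; true; false; if_then_else_)
  open import Data.Bool.ListAction using (all)
  open import Data.Nat using (ℕ; zero; suc; _≤_; z≤n; s≤s; _≡ᵇ_)
  open import Data.Nat.Properties using (≤-refl; ≤-trans; ≤-antisym; n≤1+n; suc-injective; ≡⇒≡ᵇ)
  open import Data.List using (List; []; _∷_; map; length; upTo)
  open import Data.List.Properties using (length-map; length-upTo; ∷-injectiveˡ; ∷-injectiveʳ)
  open import Data.List.Membership.Propositional using (_∈_; _∉_)
  open import Data.List.Membership.Propositional.Properties using (∈-map⁺; ∈-map⁻; ∈-upTo⁺; ∈-upTo⁻)
  open import Data.List.Relation.Unary.Any using (here; there)
  import Data.List.Relation.Unary.All as All
  open import Data.List.Relation.Unary.All.Properties using (All¬⇒¬Any; ¬Any⇒All¬)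
  open import Data.List.Relation.Unary.AllPairs using ([]; _∷_)
  open import Data.List.Relation.Unary.Unique.Propositional using (Unique)
  open import Data.List.Relation.Unary.Unique.Propositional.Properties using (upTo⁺)
  open import Data.Product using (_×_; _,_)
  open import Data.Empty using (⊥-elim)
  open import Relation.Binary.PropositionalEquality using (_≡_; refl; sym; trans; cong; subst)

  ∈-inc⁺ : ∀ {n v} → 1 ≤ v → v ≤ n → v ∈ inc n
  ∈-inc⁺ {n} {suc v} (s≤s z≤n) v≤n = ∈-map⁺ suc (∈-upTo⁺ v≤n)

  ∈-inc⁻ : ∀ {n v} → v ∈ inc n → 1 ≤ v × v ≤ n
  ∈-inc⁻ {n} m with ∈-map⁻ suc m
  ... | i , i∈upTo , refl = s≤s z≤n , ∈-upTo⁻ i∈upTo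

  Unique-inc : ∀ n → Unique (inc n)
  Unique-inc n = Unique-map suc (upTo n) (upTo⁺ n) (λ _ _ → suc-injective)

  length-inc : ∀ k → length (inc k) ≡ k
  length-inc k = trans (length-map suc (upTo k)) (length-upTo k)

  IsPermutation : ℕ → List ℕ → Set
  IsPermutation n w = Unique w × (∀ {v} → v ∈ w → 1 ≤ v × v ≤ n) × (∀ {v} → 1 ≤ v → v ≤ n → v ∈ w)

  IsPermutation⇒length≡ : ∀ {n w} → IsPermutation n w → length w ≡ n
  IsPermutation⇒length≡ {n} {w} (u , inRange , onto) =
    trans (≤-antisym (⊆⇒length≤ w (inc n) u (λ m → let (1≤v , v≤n) = inRange m in ∈-inc⁺ 1≤v v≤n))
                     (⊆⇒length≤ (inc n) w (Unique-inc n) (λ m → let (1≤v , v≤n) = ∈-inc⁻ m in onto 1≤v v≤n)))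
          (length-inc n)

  ∈-words⁻ : ∀ n m {w} → w ∈ words n m → length w ≡ n × (∀ {v} → v ∈ w → 1 ≤ v × v ≤ m)
  ∈-words⁻ zero m (here refl) = refl , λ ()
  ∈-words⁻ (suc n) m w∈ with ∈-concatMap⁻′ (λ v → map (v ∷_) (words n m)) (map suc (upTo m)) w∈
  ... | v , v∈ , w∈v with ∈-map⁻ (v ∷_) w∈v | ∈-map⁻ suc v∈
  ... | w′ , w′∈ , refl | i , i∈ , refl =
    let (len , inRange) = ∈-words⁻ n m w′∈ in
    cong suc len , λ { (here refl) → s≤s z≤n , ∈-upTo⁻ i∈ ; (there q) → inRange q }

  ∈-words⁺ : ∀ n m (w : List ℕ) → length w ≡ n → (∀ {v} → v ∈ w → 1 ≤ v × v ≤ m) → w ∈ words n m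
  ∈-words⁺ zero m [] len inRange = here refl
  ∈-words⁺ (suc n) m (x ∷ w) len inRange with inRange (here refl)
  ... | s≤s z≤n , x≤m =
    ∈-concatMap⁺′ (λ v → map (v ∷_) (words n m)) (∈-map⁺ suc (∈-upTo⁺ x≤m))
      (∈-map⁺ (x ∷_) (∈-words⁺ n m w (suc-injective len) (λ q → inRange (there q))))

  Unique-words : ∀ n m → Unique (words n m)
  Unique-words zero m = All.[] ∷ []
  Unique-words (suc n) m = Unique-concatMap (λ v → map (v ∷_) (words n m)) (map suc (upTo m))
    (Unique-map suc (upTo m) (upTo⁺ m) (λ _ _ → suc-injective))
    (λ _ → Unique-map (_ ∷_) (words n m) (Unique-words n m) (λ _ _ → ∷-injectiveʳ))
    (λ {x} {y} _ _ m₁ m₂ → let (_ , _ , e₁) = ∈-map⁻ (x ∷_) m₁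
                               (_ , _ , e₂) = ∈-map⁻ (y ∷_) m₂
                           in ∷-injectiveˡ (trans (sym e₁) e₂))

  count-∷ : ∀ v x w → count v (x ∷ w) ≡ (if x ≡ᵇ v then suc (count v w) else count v w)
  count-∷ v x w rewrite filterᵇ-∷ (λ y → y ≡ᵇ v) x w with x ≡ᵇ v
  ... | true = refl
  ... | false = refl

  count≥1⇒∈ : ∀ v w → 1 ≤ count v w → v ∈ w
  count≥1⇒∈ v (x ∷ w) 1≤c rewrite count-∷ v x w with x ≡ᵇ v in eq
  ... | true = here (sym (≡ᵇ-true⁻ eq))
  ... | false = there (count≥1⇒∈ v w 1≤c)

  ∈⇒count≥1 : ∀ {v w} → v ∈ w → 1 ≤ count v w
  ∈⇒count≥1 {v} {x ∷ w} (here refl) rewrite count-∷ v v w | ≡ᵇ-refl v = s≤s z≤n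
  ∈⇒count≥1 {v} {x ∷ w} (there m) rewrite count-∷ v x w with x ≡ᵇ v
  ... | true = s≤s z≤n
  ... | false = ∈⇒count≥1 m

  ∉⇒count≡0 : ∀ {v w} → v ∉ w → count v w ≡ 0
  ∉⇒count≡0 {v} {[]} v∉w = refl
  ∉⇒count≡0 {v} {x ∷ w} v∉w rewrite count-∷ v x w with x ≡ᵇ v in eq
  ... | true = ⊥-elim (v∉w (here (sym (≡ᵇ-true⁻ eq))))
  ... | false = ∉⇒count≡0 (λ m → v∉w (there m))

  Unique⇒count≤1 : ∀ {v w} → Unique w → count v w ≤ 1
  Unique⇒count≤1 {v} {[]} u = z≤n
  Unique⇒count≤1 {v} {x ∷ w} (x∉w ∷ u) rewrite count-∷ v x w with x ≡ᵇ v in eq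
  ... | false = Unique⇒count≤1 u
  ... | true with ≡ᵇ-true⁻ {x} {v} eq
  ... | refl rewrite ∉⇒count≡0 {v} {w} (All¬⇒¬Any x∉w) = s≤s z≤n

  count≤1⇒Unique : ∀ w → (∀ {x} → x ∈ w → count x w ≤ 1) → Unique w
  count≤1⇒Unique [] h = []
  count≤1⇒Unique (x ∷ w) h =
    ¬Any⇒All¬ w x∉w ∷ count≤1⇒Unique w (λ {y} m → ≤-trans (count-mono y) (h (there m)))
    where
    count-self : count x (x ∷ w) ≡ suc (count x w)
    count-self rewrite count-∷ x x w | ≡ᵇ-refl x = refl
    x∉w : x ∉ w
    x∉w m with ≤-trans (s≤s (∈⇒count≥1 m)) (subst (_≤ 1) count-self (h (here refl)))
    ... | s≤s ()
    count-mono : ∀ y → count y w ≤ count y (x ∷ w)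
    count-mono y rewrite count-∷ y x w with x ≡ᵇ y
    ... | true = n≤1+n _
    ... | false = ≤-refl

  permPred : ℕ → List ℕ → Bool
  permPred n w = all (λ v → count v w ≡ᵇ 1) (inc n)

  ∈-perms⁻ : ∀ n {w} → w ∈ perms n → IsPermutation n w
  ∈-perms⁻ n {w} m with ∈-filterᵇ⁻ (permPred n) (words n n) m
  ... | w∈words , isPerm with ∈-words⁻ n n w∈words
  ... | len , inRange =
    count≤1⇒Unique w (λ x∈w → let (1≤x , x≤n) = inRange x∈w in subst (_≤ 1) (sym (once 1≤x x≤n)) ≤-refl)
    , inRange
    , λ 1≤v v≤n → count≥1⇒∈ _ w (subst (1 ≤_) (sym (once 1≤v v≤n)) ≤-refl)
    where
    once : ∀ {v} → 1 ≤ v → v ≤ n → count v w ≡ 1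
    once 1≤v v≤n = ≡ᵇ-true⁻ (all-true⁻ (λ v → count v w ≡ᵇ 1) (inc n) isPerm (∈-inc⁺ 1≤v v≤n))

  ∈-perms⁺ : ∀ n {w} → IsPermutation n w → w ∈ perms n
  ∈-perms⁺ n {w} p@(u , inRange , onto) = ∈-filterᵇ⁺ (permPred n) (∈-words⁺ n n w (IsPermutation⇒length≡ p) inRange)
    (all-true⁺ (λ v → count v w ≡ᵇ 1) (inc n) λ m → let (1≤v , v≤n) = ∈-inc⁻ m in
       T⇒≡ (≡⇒≡ᵇ _ _ (≤-antisym (Unique⇒count≤1 u) (∈⇒count≥1 (onto 1≤v v≤n)))))

  Unique-perms : ∀ n → Unique (perms n)
  Unique-perms n = Unique-filterᵇ (permPred n) (Unique-words n n)

module Patterns where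

  open import Defs
  open BooleanReflection
  open Permutations using (length-inc)
  open import Data.Bool using (Bool; true; false; _∧_; _∨_; not)
  open import Data.Bool.ListAction using (all; any)
  open import Data.Nat using (ℕ; zero; suc; _+_; _<_; s≤s; _<ᵇ_)
  open import Data.Nat.Properties using (<-trans; <-asym; suc-injective; +-comm)
  open import Data.List using (List; []; _∷_; map; _++_; length; zip)
  open import Data.List.Properties using (map-++)
  open import Data.List.Membership.Propositional using (_∈_)
  open import Data.List.Membership.Propositional.Properties using (∈-++⁺ˡ; ∈-++⁺ʳ; ∈-++⁻; ∈-map⁺; ∈-map⁻)
  open import Data.List.Relation.Unary.Any using (here; there)
  open import Data.List.Relation.Unary.All using (All; []; _∷_)
  open import Data.List.Relation.Unary.AllPairs using (AllPairs; []; _∷_)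
  import Data.List.Relation.Unary.AllPairs.Properties as AllPairs
  open import Data.List.Relation.Binary.Sublist.Propositional {A = ℕ} using (_⊆_; []; _∷_; _∷ʳ_; minimum)
  open import Data.Product using (Σ; _×_; _,_; proj₁)
  open import Data.Sum using (inj₁; inj₂)
  open import Relation.Binary.PropositionalEquality using (_≡_; refl; sym; trans; cong; cong₂; subst)

  ⊆-++-split : ∀ {s : List ℕ} xs ys → s ⊆ xs ++ ys →
    Σ (List ℕ) λ s₁ → Σ (List ℕ) λ s₂ → s ≡ s₁ ++ s₂ × s₁ ⊆ xs × s₂ ⊆ ys
  ⊆-++-split [] ys p = [] , _ , refl , [] , p
  ⊆-++-split (x ∷ xs) ys (.x ∷ʳ p) with ⊆-++-split xs ys p
  ... | s₁ , s₂ , refl , p₁ , p₂ = s₁ , s₂ , refl , x ∷ʳ p₁ , p₂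
  ⊆-++-split (x ∷ xs) ys (refl ∷ p) with ⊆-++-split xs ys p
  ... | s₁ , s₂ , refl , p₁ , p₂ = x ∷ s₁ , s₂ , refl , refl ∷ p₁ , p₂

  ∈-subseqs⁻ : ∀ m w {s} → s ∈ subseqs m w → s ⊆ w × length s ≡ m
  ∈-subseqs⁻ zero w (here refl) = minimum w , refl
  ∈-subseqs⁻ (suc m) (a ∷ w) s∈ with ∈-++⁻ (map (a ∷_) (subseqs m w)) s∈
  ... | inj₂ q = let (p , len) = ∈-subseqs⁻ (suc m) w q in a ∷ʳ p , len
  ... | inj₁ q with ∈-map⁻ (a ∷_) q
  ... | s′ , q′ , refl = let (p , len) = ∈-subseqs⁻ m w q′ in refl ∷ p , cong suc len

  ∈-subseqs⁺ : ∀ {s w : List ℕ} → s ⊆ w → s ∈ subseqs (length s) w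
  ∈-subseqs⁺ [] = here refl
  ∈-subseqs⁺ {[]} (x ∷ʳ p) = here refl
  ∈-subseqs⁺ {y ∷ s} (x ∷ʳ p) = ∈-++⁺ʳ (map (x ∷_) (subseqs (length s) _)) (∈-subseqs⁺ p)
  ∈-subseqs⁺ (refl ∷ p) = ∈-++⁺ˡ (∈-map⁺ _ (∈-subseqs⁺ p))

  orderIso⇒length≡ : ∀ τ s → orderIso τ s ≡ true → length s ≡ length τ
  orderIso⇒length≡ [] [] e = refl
  orderIso⇒length≡ (a ∷ τ) (b ∷ s) e = cong suc (orderIso⇒length≡ τ s (∧-true⁻ʳ e))

  contains⁻ : ∀ τ w → contains τ w ≡ true → Σ (List ℕ) λ s → s ⊆ w × orderIso τ s ≡ true
  contains⁻ τ w e with any-true⁻ (orderIso τ) (subseqs (length τ) w) e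
  ... | s , s∈ , iso = s , proj₁ (∈-subseqs⁻ (length τ) w s∈) , iso

  contains⁺ : ∀ τ w s → s ⊆ w → orderIso τ s ≡ true → contains τ w ≡ true
  contains⁺ τ w s p iso = any-true⁺ (orderIso τ) (subseqs (length τ) w)
    (subst (λ l → s ∈ subseqs l w) (orderIso⇒length≡ τ s iso) (∈-subseqs⁺ p)) iso

  sameComparisons : ℕ → ℕ → ℕ × ℕ → Bool
  sameComparisons a b (x , y) = beq (a <ᵇ x) (b <ᵇ y) ∧ beq (x <ᵇ a) (y <ᵇ b)

  StrictlyMonotoneᵇ : (ℕ → ℕ) → Set
  StrictlyMonotoneᵇ f = ∀ x y → (f x <ᵇ f y) ≡ (x <ᵇ y)

  +-strictlyMonotoneᵇ : ∀ b → StrictlyMonotoneᵇ (_+ b)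
  +-strictlyMonotoneᵇ b x y = trans (cong₂ _<ᵇ_ (+-comm x b) (+-comm y b)) (shift b)
    where
    shift : ∀ b → ((b + x) <ᵇ (b + y)) ≡ (x <ᵇ y)
    shift zero = refl
    shift (suc b) with b + x | b + y | shift b
    ... | zero | zero | e = e
    ... | zero | suc _ | e = e
    ... | suc _ | zero | e = e
    ... | suc _ | suc _ | e = e

  orderIso-map : (f : ℕ → ℕ) → StrictlyMonotoneᵇ f → ∀ τ s → orderIso τ (map f s) ≡ orderIso τ s
  orderIso-map f mono [] [] = refl
  orderIso-map f mono [] (x ∷ s) = refl
  orderIso-map f mono (a ∷ τ) [] = refl
  orderIso-map f mono (a ∷ τ) (b ∷ s) = cong₂ _∧_ (heads τ s) (orderIso-map f mono τ s)
    where
    heads : ∀ τ s → all (sameComparisons a (f b)) (zip τ (map f s))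
                  ≡ all (sameComparisons a b) (zip τ s)
    heads [] s = refl
    heads (x ∷ τ) [] = refl
    heads (x ∷ τ) (y ∷ s) = cong₂ _∧_ (cong₂ (λ u v → beq (a <ᵇ x) u ∧ beq (x <ᵇ a) v) (mono b y) (mono y b)) (heads τ s)

  subseqs-map : (f : ℕ → ℕ) → ∀ m w → subseqs m (map f w) ≡ map (map f) (subseqs m w)
  subseqs-map f zero w = refl
  subseqs-map f (suc m) [] = refl
  subseqs-map f (suc m) (a ∷ w) rewrite subseqs-map f m w | subseqs-map f (suc m) w
    | map-++ (map f) (map (a ∷_) (subseqs m w)) (subseqs (suc m) w) = cong (_++ _) (cons-map (subseqs m w))
    where
    cons-map : ∀ ss → map (f a ∷_) (map (map f) ss) ≡ map (map f) (map (a ∷_) ss)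
    cons-map [] = refl
    cons-map (s ∷ ss) = cong (_ ∷_) (cons-map ss)

  contains-map : (f : ℕ → ℕ) → StrictlyMonotoneᵇ f → ∀ τ w → contains τ (map f w) ≡ contains τ w
  contains-map f mono τ w rewrite subseqs-map f (length τ) w = any-map (subseqs (length τ) w)
    where
    any-map : ∀ ss → any (orderIso τ) (map (map f) ss) ≡ any (orderIso τ) ss
    any-map [] = refl
    any-map (s ∷ ss) = cong₂ _∨_ (orderIso-map f mono τ s) (any-map ss)

  avoids-+ : ∀ b τ w → avoids τ (map (_+ b) w) ≡ avoids τ w
  avoids-+ b τ w = cong not (contains-map (_+ b) (+-strictlyMonotoneᵇ b) τ w)

  Has132 : List ℕ → Set
  Has132 w = Σ ℕ λ a → Σ ℕ λ b → Σ ℕ λ c → a ∷ b ∷ c ∷ [] ⊆ w × a < c × c < b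

  beq-true⁻ : ∀ x → beq true x ≡ true → x ≡ true
  beq-true⁻ true e = refl

  orderIso-∷⁻ : ∀ a τ b s → orderIso (a ∷ τ) (b ∷ s) ≡ true →
    all (sameComparisons a b) (zip τ s) ≡ true × orderIso τ s ≡ true
  orderIso-∷⁻ a τ b s e = ∧-true⁻ˡ e , ∧-true⁻ʳ e

  iso132⁻ : ∀ a b c → orderIso p132 (a ∷ b ∷ c ∷ []) ≡ true → a < c × c < b
  iso132⁻ a b c e =
    let (heads₁ , rest) = orderIso-∷⁻ 1 (3 ∷ 2 ∷ []) a (b ∷ c ∷ []) e
        (heads₂ , _) = orderIso-∷⁻ 3 (2 ∷ []) b (c ∷ []) rest
    in <ᵇ-true⁻ (beq-true⁻ _ (∧-true⁻ˡ (all-true⁻ (sameComparisons 1 a) (zip (3 ∷ 2 ∷ []) (b ∷ c ∷ []))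
                                                    heads₁ (there (here refl)))))
     , <ᵇ-true⁻ (beq-true⁻ _ (∧-true⁻ʳ (all-true⁻ (sameComparisons 3 b) (zip (2 ∷ []) (c ∷ [])) heads₂ (here refl))))

  iso132⁺ : ∀ a b c → a < c → c < b → orderIso p132 (a ∷ b ∷ c ∷ []) ≡ true
  iso132⁺ a b c a<c c<b
    rewrite <ᵇ-true (<-trans a<c c<b) | <ᵇ-false (<-asym (<-trans a<c c<b)) | <ᵇ-true a<c | <ᵇ-false (<-asym a<c)
          | <ᵇ-true c<b | <ᵇ-false (<-asym c<b) = refl

  contains132⁻ : ∀ w → contains p132 w ≡ true → Has132 w
  contains132⁻ w e with contains⁻ p132 w e
  ... | s , p , iso with orderIso⇒length≡ p132 s iso
  contains132⁻ w e | a ∷ b ∷ c ∷ [] , p , iso | refl = let (a<c , c<b) = iso132⁻ a b c iso in a , b , c , p , a<c , c<b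

  contains132⁺ : ∀ w → Has132 w → contains p132 w ≡ true
  contains132⁺ w (a , b , c , p , a<c , c<b) = contains⁺ p132 w _ p (iso132⁺ a b c a<c c<b)

  HasIncreasing : ℕ → List ℕ → Set
  HasIncreasing k w = Σ (List ℕ) λ s → s ⊆ w × length s ≡ k × AllPairs _<_ s

  comparison-with-smaller : ∀ t x b y → t < x → sameComparisons t b (x , y) ≡ (b <ᵇ y)
  comparison-with-smaller t x b y t<x rewrite <ᵇ-true t<x | <ᵇ-false (<-asym t<x) with b <ᵇ y in b<y
  ... | false with y <ᵇ b
  ... | true = refl
  ... | false = refl
  comparison-with-smaller t x b y t<x | true rewrite <ᵇ-false {y} {b} (<-asym (<ᵇ-true⁻ {b} {y} b<y)) = refl

  orderIso-increasing⁻ : ∀ τ s → AllPairs _<_ τ → orderIso τ s ≡ true → AllPairs _<_ s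
  orderIso-increasing⁻ [] [] _ _ = []
  orderIso-increasing⁻ (t ∷ τ) (b ∷ s) (t<τ ∷ τ↑) e =
    heads τ s t<τ (sym (orderIso⇒length≡ τ s (∧-true⁻ʳ e))) (∧-true⁻ˡ e)
    ∷ orderIso-increasing⁻ τ s τ↑ (∧-true⁻ʳ e)
    where
    heads : ∀ τ s → All (t <_) τ → length τ ≡ length s →
      all (sameComparisons t b) (zip τ s) ≡ true → All (b <_) s
    heads [] [] _ _ _ = []
    heads (x ∷ τ) (y ∷ s) (t<x ∷ t<τ) len e =
      <ᵇ-true⁻ (trans (sym (comparison-with-smaller t x b y t<x)) (∧-true⁻ˡ e))
      ∷ heads τ s t<τ (suc-injective len) (∧-true⁻ʳ e)

  orderIso-increasing⁺ : ∀ τ s → AllPairs _<_ τ → length τ ≡ length s → AllPairs _<_ s → orderIso τ s ≡ true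
  orderIso-increasing⁺ [] [] _ _ _ = refl
  orderIso-increasing⁺ (t ∷ τ) (b ∷ s) (t<τ ∷ τ↑) len (b<s ∷ s↑) =
    cong₂ _∧_ (heads τ s t<τ b<s) (orderIso-increasing⁺ τ s τ↑ (suc-injective len) s↑)
    where
    heads : ∀ τ s → All (t <_) τ → All (b <_) s →
      all (sameComparisons t b) (zip τ s) ≡ true
    heads [] s _ _ = refl
    heads (x ∷ τ) [] _ _ = refl
    heads (x ∷ τ) (y ∷ s) (t<x ∷ t<τ) (b<y ∷ b<s)
      rewrite comparison-with-smaller t x b y t<x | <ᵇ-true b<y = heads τ s t<τ b<s

  inc-increasing : ∀ k → AllPairs _<_ (inc k)
  inc-increasing k = AllPairs.map⁺ (AllPairs.applyUpTo⁺₁ (λ i → i) k (λ i<j _ → s≤s i<j))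

  containsInc⁻ : ∀ k w → contains (inc k) w ≡ true → HasIncreasing k w
  containsInc⁻ k w e with contains⁻ (inc k) w e
  ... | s , p , iso = s , p , trans (orderIso⇒length≡ (inc k) s iso) (length-inc k)
                    , orderIso-increasing⁻ (inc k) s (inc-increasing k) iso

  containsInc⁺ : ∀ k w → HasIncreasing k w → contains (inc k) w ≡ true
  containsInc⁺ k w (s , p , len , s↑) =
    contains⁺ (inc k) w s p (orderIso-increasing⁺ (inc k) s (inc-increasing k) (trans (length-inc k) (sym len)) s↑)

module Splitting where

  open import Defs
  open BooleanReflection
  open Patterns
  open import Data.Bool using (true; false; _∧_; _∨_; not)
  open import Data.Nat using (ℕ; suc; _<_)
  open import Data.Nat.Properties using (<-asym; suc-injective; +-comm)
  open import Data.List using (List; []; _∷_; _++_; length)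
  open import Data.List.Properties using (length-++; ++-identityʳ; ++-assoc)
  open import Data.List.Membership.Propositional using (_∈_)
  open import Data.List.Membership.Propositional.Properties using (∈-++⁺ʳ)
  open import Data.List.Relation.Unary.Any using (here; there)
  import Data.List.Relation.Unary.All as All
  import Data.List.Relation.Unary.All.Properties as All
  open import Data.List.Relation.Unary.AllPairs using (AllPairs; []; _∷_)
  import Data.List.Relation.Unary.AllPairs.Properties as AllPairs
  open import Data.List.Relation.Binary.Sublist.Propositional {A = ℕ} using (_∷_; _∷ʳ_; minimum; lookup)
  open import Data.List.Relation.Binary.Sublist.Propositional.Properties using (∷ˡ⁻; ++⁺; ++⁺ˡ)
  open import Data.Product using (_×_; _,_)
  open import Data.Sum using (_⊎_; inj₁; inj₂)
  open import Data.Empty using (⊥-elim)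
  open import Relation.Nullary using (¬_)
  open import Relation.Binary.PropositionalEquality using (_≡_; refl; sym; trans; cong; subst)

  SplitAtMax : List ℕ → ℕ → List ℕ → Set
  SplitAtMax A N B = (∀ {v u} → v ∈ A → u ∈ B → u < v) × (∀ {v} → v ∈ A → v < N) × (∀ {u} → u ∈ B → u < N)

  ¬Has132-split : ∀ A N B → SplitAtMax A N B → ¬ Has132 A → ¬ Has132 B → ¬ Has132 (A ++ N ∷ B)
  ¬Has132-split A N B (B<A , A<N , B<N) ¬A ¬B (x , y , z , p , x<z , z<y) with ⊆-++-split A (N ∷ B) p
  ... | [] , ._ , refl , _ , _ ∷ʳ q = ¬B (x , y , z , q , x<z , z<y)
  ... | [] , ._ , refl , _ , refl ∷ q = <-asym x<z (B<N (lookup q (there (here refl))))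
  ... | x ∷ [] , ._ , refl , p₁ , _ ∷ʳ q = <-asym x<z (B<A (lookup p₁ (here refl)) (lookup q (there (here refl))))
  ... | x ∷ [] , ._ , refl , p₁ , refl ∷ q = <-asym x<z (B<A (lookup p₁ (here refl)) (lookup q (here refl)))
  ... | x ∷ y ∷ [] , ._ , refl , p₁ , _ ∷ʳ q = <-asym x<z (B<A (lookup p₁ (here refl)) (lookup q (here refl)))
  ... | x ∷ y ∷ [] , ._ , refl , p₁ , refl ∷ q = <-asym z<y (A<N (lookup p₁ (there (here refl))))
  ... | x ∷ y ∷ z ∷ [] , [] , refl , p₁ , q = ¬A (x , y , z , p₁ , x<z , z<y)

  private
    increasing-++⁻ˡ : ∀ xs {ys : List ℕ} → AllPairs _<_ (xs ++ ys) → AllPairs _<_ xs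
    increasing-++⁻ˡ [] _ = []
    increasing-++⁻ˡ (x ∷ xs) (x<xs ∷ xs↑) = All.++⁻ˡ xs x<xs ∷ increasing-++⁻ˡ xs xs↑

    increasing-++⁻ : ∀ xs {ys : List ℕ} {x y} → AllPairs _<_ (xs ++ ys) → x ∈ xs → y ∈ ys → x < y
    increasing-++⁻ (z ∷ xs) (z<xs ∷ _) (here refl) y∈ys = All.lookup z<xs (∈-++⁺ʳ xs y∈ys)
    increasing-++⁻ (z ∷ xs) (_ ∷ xs↑) (there x∈xs) y∈ys = increasing-++⁻ xs xs↑ x∈xs y∈ys

  HasIncreasing-∷⁻ : ∀ {k w} → HasIncreasing (suc k) w → HasIncreasing k w
  HasIncreasing-∷⁻ (x ∷ s , p , len , _ ∷ s↑) = s , ∷ˡ⁻ p , suc-injective len , s↑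

  increasing-split⁻ : ∀ A N B k → SplitAtMax A N B → HasIncreasing (suc k) (A ++ N ∷ B) →
    HasIncreasing k A ⊎ HasIncreasing (suc k) B
  increasing-split⁻ A N B k (B<A , A<N , B<N) (s , p , len , s↑) with ⊆-++-split A (N ∷ B) p
  ... | s₁ , [] , refl , p₁ , _ rewrite ++-identityʳ s₁ = inj₁ (HasIncreasing-∷⁻ (s₁ , p₁ , len , s↑))
  ... | s₁ , N ∷ [] , refl , p₁ , refl ∷ _ =
    inj₁ (s₁ , p₁ , suc-injective (trans (+-comm 1 (length s₁)) (trans (sym (length-++ s₁)) len)) , increasing-++⁻ˡ s₁ s↑)
  ... | s₁ , N ∷ y ∷ s₂ , refl , _ , refl ∷ q =
    ⊥-elim (<-asym (B<N (lookup q (here refl)))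
      (increasing-++⁻ (s₁ ++ N ∷ []) (subst (AllPairs _<_) (sym (++-assoc s₁ (N ∷ []) (y ∷ s₂))) s↑)
        (∈-++⁺ʳ s₁ (here refl)) (here refl)))
  ... | [] , y ∷ s₂ , refl , _ , _ ∷ʳ q = inj₂ (y ∷ s₂ , q , len , s↑)
  ... | x ∷ s₁ , y ∷ s₂ , refl , p₁ , _ ∷ʳ q =
    ⊥-elim (<-asym (increasing-++⁻ (x ∷ s₁) s↑ (here refl) (here refl)) (B<A (lookup p₁ (here refl)) (lookup q (here refl))))

  increasing-split⁺ˡ : ∀ A N B k → SplitAtMax A N B → HasIncreasing k A → HasIncreasing (suc k) (A ++ N ∷ B)
  increasing-split⁺ˡ A N B k (_ , A<N , _) (s , p , len , s↑) =
    s ++ N ∷ [] , ++⁺ p (refl ∷ minimum B) , trans (length-++ s) (trans (+-comm (length s) 1) (cong suc len))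
    , AllPairs.++⁺ s↑ (All.[] ∷ []) (All.tabulate (λ m → A<N (lookup p m) All.∷ All.[]))

  increasing-split⁺ʳ : ∀ A N B k → HasIncreasing k B → HasIncreasing k (A ++ N ∷ B)
  increasing-split⁺ʳ A N B k (s , p , len , s↑) = s , ++⁺ˡ A (N ∷ʳ p) , len , s↑

  contains-inc-split : ∀ A N B k → SplitAtMax A N B →
    contains (inc (suc k)) (A ++ N ∷ B) ≡ (contains (inc k) A ∨ contains (inc (suc k)) B)
  contains-inc-split A N B k split
    with contains (inc (suc k)) (A ++ N ∷ B) in e | contains (inc k) A in eA | contains (inc (suc k)) B in eB
  ... | true | true | _ = refl
  ... | true | false | true = refl
  ... | true | false | false with increasing-split⁻ A N B k split (containsInc⁻ (suc k) _ e)
  ...   | inj₁ h = true≢false (trans (sym (containsInc⁺ k A h)) eA)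
  ...   | inj₂ h = true≢false (trans (sym (containsInc⁺ (suc k) B h)) eB)
  contains-inc-split A N B k split | false | true | _ =
    true≢false (trans (sym (containsInc⁺ (suc k) _ (increasing-split⁺ˡ A N B k split (containsInc⁻ k A eA)))) e)
  contains-inc-split A N B k split | false | false | true =
    true≢false (trans (sym (containsInc⁺ (suc k) _ (increasing-split⁺ʳ A N B (suc k) (containsInc⁻ (suc k) B eB)))) e)
  contains-inc-split A N B k split | false | false | false = refl

  avoids-inc-split : ∀ A N B k → SplitAtMax A N B →
    avoids (inc (suc k)) (A ++ N ∷ B) ≡ avoids (inc k) A ∧ avoids (inc (suc k)) B
  avoids-inc-split A N B k split =
    trans (cong not (contains-inc-split A N B k split)) (not-∨ (contains (inc k) A) (contains (inc (suc k)) B))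

module MaxDecomposition where

  open import Defs
  open Lists
  open BooleanReflection
  open Permutations
  open Patterns
  open Splitting
  open import Data.Bool using (Bool; true; false; _∧_)
  open import Data.Nat using (ℕ; zero; suc; _+_; _*_; _∸_; _≤_; _<_; z≤n; s≤s)
  open import Data.Nat.Properties
  open import Data.List using (List; []; _∷_; map; concatMap; _++_; length; filterᵇ)
  open import Data.List.Properties
    using (length-map; map-injective; ++-cancelˡ; concatMap-++; ++-identityʳ; ∷-injectiveˡ; ∷-injectiveʳ; map-∘; map-id-local)
  open import Data.List.Membership.Propositional using (_∈_; _∉_)
  open import Data.List.Membership.Propositional.Properties using (∈-++⁺ˡ; ∈-++⁺ʳ; ∈-++⁻; ∈-∃++; ∈-map⁺; ∈-map⁻)
  open import Data.List.Membership.DecPropositional _≟_ using (_∈?_)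
  open import Data.List.Relation.Unary.Any using (here; there)
  import Data.List.Relation.Unary.All as All
  open import Data.List.Relation.Unary.All.Properties using (All¬⇒¬Any; ¬Any⇒All¬)
  open import Data.List.Relation.Unary.AllPairs using ([]; _∷_)
  open import Data.List.Relation.Unary.Unique.Propositional using (Unique)
  import Data.List.Relation.Unary.Unique.Propositional.Properties as Unique
  open import Data.List.Relation.Binary.Sublist.Propositional {A = ℕ} using (_∷_; _∷ʳ_; from∈)
  open import Data.List.Relation.Binary.Sublist.Propositional.Properties using (++⁺; ++⁺ˡ; ++⁺ʳ)
  open import Data.Product using (_×_; _,_; proj₁; proj₂)
  open import Data.Sum using (inj₁; inj₂)
  open import Data.Empty using (⊥; ⊥-elim)
  open import Function using (_∘_)
  open import Relation.Nullary using (¬_; yes; no)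
  open import Relation.Binary.Definitions using (tri<; tri≈; tri>)
  open import Relation.Binary.PropositionalEquality using (_≡_; _≢_; refl; sym; trans; cong; cong₂; subst)

  Av132 : ℕ → List (List ℕ)
  Av132 m = filterᵇ (avoids p132) (perms m)

  count132 : (List ℕ → Bool) → ℕ → ℕ
  count132 p m = length (filterᵇ p (Av132 m))

  sumℕ : ℕ → (ℕ → ℕ) → ℕ
  sumℕ zero f = f 0
  sumℕ (suc n) f = sumℕ n f + f (suc n)

  zeroTo : ℕ → List ℕ
  zeroTo zero = 0 ∷ []
  zeroTo (suc n) = zeroTo n ++ suc n ∷ []

  glue : ℕ → ℕ → List ℕ → List ℕ → List ℕ
  glue b N α β = map (_+ b) α ++ N ∷ β

  gluingsAt : ℕ → ℕ → List (List ℕ)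
  gluingsAt n a = concatMap (λ α → map (glue (n ∸ a) (suc n) α) (Av132 (n ∸ a))) (Av132 a)

  gluings : ℕ → List (List ℕ)
  gluings n = concatMap (gluingsAt n) (zeroTo n)

  ∈-zeroTo⁻ : ∀ n {a} → a ∈ zeroTo n → a ≤ n
  ∈-zeroTo⁻ zero (here refl) = z≤n
  ∈-zeroTo⁻ (suc n) a∈ with ∈-++⁻ (zeroTo n) a∈
  ... | inj₁ a∈′ = m≤n⇒m≤1+n (∈-zeroTo⁻ n a∈′)
  ... | inj₂ (here refl) = ≤-refl

  ∈-zeroTo⁺ : ∀ n {a} → a ≤ n → a ∈ zeroTo n
  ∈-zeroTo⁺ zero z≤n = here refl
  ∈-zeroTo⁺ (suc n) {a} a≤1+n with m≤n⇒m<n∨m≡n a≤1+n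
  ... | inj₁ a<1+n = ∈-++⁺ˡ (∈-zeroTo⁺ n (≤-pred a<1+n))
  ... | inj₂ refl = ∈-++⁺ʳ (zeroTo n) (here refl)

  Unique-zeroTo : ∀ n → Unique (zeroTo n)
  Unique-zeroTo zero = All.[] ∷ []
  Unique-zeroTo (suc n) = Unique.++⁺ (Unique-zeroTo n) (All.[] ∷ [])
    (λ { (a∈ , here refl) → <-irrefl refl (s≤s (∈-zeroTo⁻ n a∈)) })

  length-filterᵇ-zeroTo : (r : List ℕ → Bool) (h : ℕ → List (List ℕ)) (n : ℕ) →
    length (filterᵇ r (concatMap h (zeroTo n))) ≡ sumℕ n (λ a → length (filterᵇ r (h a)))
  length-filterᵇ-zeroTo r h zero = cong (length ∘ filterᵇ r) (++-identityʳ (h 0))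
  length-filterᵇ-zeroTo r h (suc n)
    rewrite concatMap-++ h (zeroTo n) (suc n ∷ []) | length-filterᵇ-++ r (concatMap h (zeroTo n)) (h (suc n) ++ [])
          | length-filterᵇ-zeroTo r h n | ++-identityʳ (h (suc n)) = refl

  sumℕ-cong : ∀ m {f g : ℕ → ℕ} → (∀ a → a ≤ m → f a ≡ g a) → sumℕ m f ≡ sumℕ m g
  sumℕ-cong zero f≡g = f≡g 0 z≤n
  sumℕ-cong (suc m) f≡g = cong₂ _+_ (sumℕ-cong m (λ a a≤m → f≡g a (m≤n⇒m≤1+n a≤m))) (f≡g (suc m) ≤-refl)

  length-filterᵇ-gluings : (r p q : List ℕ → Bool) (n : ℕ) →
    (∀ {a α β} → a ≤ n → α ∈ Av132 a → β ∈ Av132 (n ∸ a) → r (glue (n ∸ a) (suc n) α β) ≡ p α ∧ q β) →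
    length (filterᵇ r (gluings n)) ≡ sumℕ n (λ a → count132 p a * count132 q (n ∸ a))
  length-filterᵇ-gluings r p q n factor = trans (length-filterᵇ-zeroTo r (gluingsAt n) n) (sumℕ-cong n λ a a≤n →
    length-filterᵇ-product r p q (glue (n ∸ a) (suc n)) (Av132 a) (Av132 (n ∸ a)) (factor a≤n))

  Av132-isPermutation : ∀ {m α} → α ∈ Av132 m → IsPermutation m α
  Av132-isPermutation {m} α∈ = ∈-perms⁻ m (proj₁ (∈-filterᵇ⁻ (avoids p132) (perms m) α∈))

  Av132-avoids : ∀ {m α} → α ∈ Av132 m → avoids p132 α ≡ true
  Av132-avoids {m} α∈ = proj₂ (∈-filterᵇ⁻ (avoids p132) (perms m) α∈)

  ∈-Av132 : ∀ {m α} → IsPermutation m α → avoids p132 α ≡ true → α ∈ Av132 m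
  ∈-Av132 {m} isPerm av = ∈-filterᵇ⁺ (avoids p132) (∈-perms⁺ m isPerm) av

  Unique-Av132 : ∀ m → Unique (Av132 m)
  Unique-Av132 m = Unique-filterᵇ (avoids p132) (Unique-perms m)

  Av132-length : ∀ {m α} → α ∈ Av132 m → length α ≡ m
  Av132-length {m} α∈ = IsPermutation⇒length≡ (Av132-isPermutation {m} α∈)

  avoids132⁺ : ∀ w → ¬ Has132 w → avoids p132 w ≡ true
  avoids132⁺ w ¬has with contains p132 w in e
  ... | true = ⊥-elim (¬has (contains132⁻ w e))
  ... | false = refl

  avoids132⁻ : ∀ w → avoids p132 w ≡ true → ¬ Has132 w
  avoids132⁻ w av has with contains p132 w in e
  avoids132⁻ w () has | true
  avoids132⁻ w av has | false = true≢false (trans (sym (contains132⁺ w has)) e)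

  shifted-range : ∀ {n a α v} → a ≤ n → α ∈ Av132 a → v ∈ map (_+ (n ∸ a)) α → n ∸ a < v × v ≤ n
  shifted-range {n} {a} a≤n α∈ v∈ with ∈-map⁻ (_+ (n ∸ a)) v∈
  ... | x , x∈α , refl with proj₁ (proj₂ (Av132-isPermutation {a} α∈)) x∈α
  ... | 1≤x , x≤a = +-monoˡ-≤ (n ∸ a) 1≤x , subst (x + (n ∸ a) ≤_) (m+[n∸m]≡n a≤n) (+-monoˡ-≤ (n ∸ a) x≤a)

  glue-splitAtMax : ∀ n a α β → a ≤ n → α ∈ Av132 a → β ∈ Av132 (n ∸ a) → SplitAtMax (map (_+ (n ∸ a)) α) (suc n) β
  glue-splitAtMax n a α β a≤n α∈ β∈ =
      (λ v∈ u∈ → ≤-<-trans (proj₂ (β-range u∈)) (proj₁ (shifted-range a≤n α∈ v∈)))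
    , (λ v∈ → s≤s (proj₂ (shifted-range a≤n α∈ v∈)))
    , (λ u∈ → s≤s (≤-trans (proj₂ (β-range u∈)) (m∸n≤m n a)))
    where
    β-range : ∀ {u} → u ∈ β → 1 ≤ u × u ≤ n ∸ a
    β-range = proj₁ (proj₂ (Av132-isPermutation {n ∸ a} β∈))

  glue-isPermutation : ∀ n a α β → a ≤ n → α ∈ Av132 a → β ∈ Av132 (n ∸ a) →
    IsPermutation (suc n) (glue (n ∸ a) (suc n) α β)
  glue-isPermutation n a α β a≤n α∈ β∈ = unique , inRange , onto
    where
    b : ℕ
    b = n ∸ a
    A : List ℕ
    A = map (_+ b) α
    b≤n : b ≤ n
    b≤n = m∸n≤m n a
    uα : Unique α
    uα = proj₁ (Av132-isPermutation {a} α∈)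
    ontoα : ∀ {v} → 1 ≤ v → v ≤ a → v ∈ α
    ontoα = proj₂ (proj₂ (Av132-isPermutation {a} α∈))
    uβ : Unique β
    uβ = proj₁ (Av132-isPermutation {n ∸ a} β∈)
    β-range : ∀ {u} → u ∈ β → 1 ≤ u × u ≤ b
    β-range = proj₁ (proj₂ (Av132-isPermutation {n ∸ a} β∈))
    ontoβ : ∀ {v} → 1 ≤ v → v ≤ b → v ∈ β
    ontoβ = proj₂ (proj₂ (Av132-isPermutation {n ∸ a} β∈))
    N∉β : suc n ∉ β
    N∉β m = <-irrefl refl (s≤s (≤-trans (proj₂ (β-range m)) b≤n))
    unique : Unique (A ++ suc n ∷ β)
    unique = Unique.++⁺ (Unique-map (_+ b) α uα (λ _ _ → +-cancelʳ-≡ b _ _))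
      (¬Any⇒All¬ β N∉β ∷ uβ)
      (λ { (m₁ , here refl) → <-irrefl refl (s≤s (proj₂ (shifted-range a≤n α∈ m₁)))
         ; (m₁ , there m₂) → <-irrefl refl (≤-trans (proj₁ (shifted-range a≤n α∈ m₁)) (proj₂ (β-range m₂))) })
    inRange : ∀ {v} → v ∈ A ++ suc n ∷ β → 1 ≤ v × v ≤ suc n
    inRange m with ∈-++⁻ A m
    ... | inj₁ m₁ = let (b<v , v≤n) = shifted-range a≤n α∈ m₁ in ≤-trans (s≤s z≤n) b<v , m≤n⇒m≤1+n v≤n
    ... | inj₂ (here refl) = s≤s z≤n , ≤-refl
    ... | inj₂ (there m₂) = proj₁ (β-range m₂) , m≤n⇒m≤1+n (≤-trans (proj₂ (β-range m₂)) b≤n)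
    onto : ∀ {v} → 1 ≤ v → v ≤ suc n → v ∈ A ++ suc n ∷ β
    onto {v} 1≤v v≤1+n with m≤n⇒m<n∨m≡n v≤1+n
    ... | inj₂ refl = ∈-++⁺ʳ A (here refl)
    ... | inj₁ v<1+n with v ≤? b
    ...   | yes v≤b = ∈-++⁺ʳ A (there (ontoβ 1≤v v≤b))
    ...   | no v≰b = subst (_∈ A ++ suc n ∷ β) (m∸n+n≡m (<⇒≤ b<v)) (∈-++⁺ˡ (∈-map⁺ (_+ b) (ontoα 1≤v∸b v∸b≤a)))
      where
      b<v : b < v
      b<v = ≰⇒> v≰b
      1≤v∸b : 1 ≤ v ∸ b
      1≤v∸b = subst (_≤ v ∸ b) (m+n∸n≡m 1 b) (∸-monoˡ-≤ b b<v)
      v∸b≤a : v ∸ b ≤ a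
      v∸b≤a = subst (v ∸ b ≤_) (trans (cong (_∸ b) (sym (m+[n∸m]≡n a≤n))) (m+n∸n≡m a b)) (∸-monoˡ-≤ b (≤-pred v<1+n))

  glue-∈-Av132 : ∀ n a α β → a ≤ n → α ∈ Av132 a → β ∈ Av132 (n ∸ a) → glue (n ∸ a) (suc n) α β ∈ Av132 (suc n)
  glue-∈-Av132 n a α β a≤n α∈ β∈ = ∈-Av132 (glue-isPermutation n a α β a≤n α∈ β∈)
    (avoids132⁺ _ (¬Has132-split (map (_+ (n ∸ a)) α) (suc n) β (glue-splitAtMax n a α β a≤n α∈ β∈) ¬Has132-α
      (avoids132⁻ β (Av132-avoids {n ∸ a} β∈))))
    where
    ¬Has132-α : ¬ Has132 (map (_+ (n ∸ a)) α)
    ¬Has132-α has = avoids132⁻ α (Av132-avoids {a} α∈)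
      (contains132⁻ α (trans (sym (contains-map (_+ (n ∸ a)) (+-strictlyMonotoneᵇ (n ∸ a)) p132 α)) (contains132⁺ _ has)))

  ++-prefix-unique : ∀ N (xs ys xs′ ys′ : List ℕ) → N ∉ xs → N ∉ xs′ → xs ++ N ∷ ys ≡ xs′ ++ N ∷ ys′ → xs ≡ xs′
  ++-prefix-unique N [] ys [] ys′ _ _ e = refl
  ++-prefix-unique N [] ys (x′ ∷ xs′) ys′ _ N∉xs′ e = ⊥-elim (N∉xs′ (here (∷-injectiveˡ e)))
  ++-prefix-unique N (x ∷ xs) ys [] ys′ N∉xs _ e = ⊥-elim (N∉xs (here (sym (∷-injectiveˡ e))))
  ++-prefix-unique N (x ∷ xs) ys (x′ ∷ xs′) ys′ N∉xs N∉xs′ e =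
    cong₂ _∷_ (∷-injectiveˡ e) (++-prefix-unique N xs ys xs′ ys′ (N∉xs ∘ there) (N∉xs′ ∘ there) (∷-injectiveʳ e))

  ++-prefix-length : ∀ (xs ys xs′ ys′ : List ℕ) → length xs ≡ length xs′ → xs ++ ys ≡ xs′ ++ ys′ → xs ≡ xs′
  ++-prefix-length [] ys [] ys′ _ _ = refl
  ++-prefix-length (x ∷ xs) ys (x′ ∷ xs′) ys′ len e =
    cong₂ _∷_ (∷-injectiveˡ e) (++-prefix-length xs ys xs′ ys′ (suc-injective len) (∷-injectiveʳ e))

  Unique-gluingsAt : ∀ n a → Unique (gluingsAt n a)
  Unique-gluingsAt n a = Unique-concatMap (λ α → map (glue b (suc n) α) (Av132 b)) (Av132 a) (Unique-Av132 a)
    (λ {α} _ → Unique-map (glue b (suc n) α) (Av132 b) (Unique-Av132 b)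
        (λ _ _ e → ∷-injectiveʳ (++-cancelˡ (map (_+ b) α) _ _ e)))
    (λ {α} {α′} α∈ α′∈ z∈ z∈′ →
       let (β , _ , e) = ∈-map⁻ (glue b (suc n) α) z∈
           (β′ , _ , e′) = ∈-map⁻ (glue b (suc n) α′) z∈′
       in map-injective (λ {x} {y} → +-cancelʳ-≡ b x y)
            (++-prefix-length (map (_+ b) α) _ (map (_+ b) α′) _
               (trans (length-map (_+ b) α) (trans (trans (Av132-length {a} α∈) (sym (Av132-length {a} α′∈))) (sym (length-map (_+ b) α′))))
               (trans (sym e) e′)))
    where
    b : ℕ
    b = n ∸ a

  Unique-gluings : ∀ n → Unique (gluings n)
  Unique-gluings n = Unique-concatMap (gluingsAt n) (zeroTo n) (Unique-zeroTo n) (λ {a} _ → Unique-gluingsAt n a) disjoint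
    where
    disjoint : ∀ {a a′ z} → a ∈ zeroTo n → a′ ∈ zeroTo n → z ∈ gluingsAt n a → z ∈ gluingsAt n a′ → a ≡ a′
    disjoint {a} {a′} a∈ a′∈ z∈ z∈′
      with ∈-concatMap⁻′ (λ α → map (glue (n ∸ a) (suc n) α) (Av132 (n ∸ a))) (Av132 a) z∈
         | ∈-concatMap⁻′ (λ α → map (glue (n ∸ a′) (suc n) α) (Av132 (n ∸ a′))) (Av132 a′) z∈′
    ... | α , α∈ , zα | α′ , α′∈ , zα′ with ∈-map⁻ (glue (n ∸ a) (suc n) α) zα | ∈-map⁻ (glue (n ∸ a′) (suc n) α′) zα′
    ... | β , _ , e | β′ , _ , e′ =
      let a≤n = ∈-zeroTo⁻ n a∈
          a′≤n = ∈-zeroTo⁻ n a′∈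
          same-prefix = ++-prefix-unique (suc n) (map (_+ (n ∸ a)) α) β (map (_+ (n ∸ a′)) α′) β′
                 (λ m → <-irrefl refl (s≤s (proj₂ (shifted-range a≤n α∈ m))))
                 (λ m → <-irrefl refl (s≤s (proj₂ (shifted-range a′≤n α′∈ m))))
                 (trans (sym e) e′)
      in trans (sym (Av132-length α∈)) (trans (sym (length-map (_+ (n ∸ a)) α))
           (trans (cong length same-prefix) (trans (length-map (_+ (n ∸ a′)) α′) (Av132-length α′∈))))

  gluings-⊆-Av132 : ∀ n {w} → w ∈ gluings n → w ∈ Av132 (suc n)
  gluings-⊆-Av132 n w∈ with ∈-concatMap⁻′ (gluingsAt n) (zeroTo n) w∈
  ... | a , a∈ , w∈a with ∈-concatMap⁻′ (λ α → map (glue (n ∸ a) (suc n) α) (Av132 (n ∸ a))) (Av132 a) w∈a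
  ... | α , α∈ , w∈α with ∈-map⁻ (glue (n ∸ a) (suc n) α) w∈α
  ... | β , β∈ , refl = glue-∈-Av132 n a α β (∈-zeroTo⁻ n a∈) α∈ β∈

  module SplitAvoider {n : ℕ} (A B : List ℕ)
    (isPerm : IsPermutation (suc n) (A ++ suc n ∷ B)) (avoids132 : avoids p132 (A ++ suc n ∷ B) ≡ true) where

    private
      N : ℕ
      N = suc n
      w : List ℕ
      w = A ++ N ∷ B
      ¬has132 : ¬ Has132 w
      ¬has132 = avoids132⁻ w avoids132
      inRange : ∀ {v} → v ∈ w → 1 ≤ v × v ≤ N
      inRange = proj₁ (proj₂ isPerm)
      onto : ∀ {v} → 1 ≤ v → v ≤ N → v ∈ w
      onto = proj₂ (proj₂ isPerm)
      split-unique : Unique A × Unique (N ∷ B) × (∀ {z} → z ∈ A → z ∈ N ∷ B → ⊥)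
      split-unique = Unique-++⁻ A (N ∷ B) (proj₁ isPerm)
      A∩NB=∅ : ∀ {z} → z ∈ A → z ∈ N ∷ B → ⊥
      A∩NB=∅ = proj₂ (proj₂ split-unique)
      inA : ∀ {v} → v ∈ A → v ∈ w
      inA = ∈-++⁺ˡ
      inB : ∀ {v} → v ∈ B → v ∈ w
      inB = ∈-++⁺ʳ A ∘ there
      below-N : ∀ {v} → v ∈ w → v ≢ N → v ≤ n
      below-N m v≢N with m≤n⇒m<n∨m≡n (proj₂ (inRange m))
      ... | inj₁ v<N = ≤-pred v<N
      ... | inj₂ v≡N = ⊥-elim (v≢N v≡N)

    uA : Unique A
    uA = proj₁ split-unique

    uB : Unique B
    uB with proj₁ (proj₂ split-unique)
    ... | _ ∷ u = u

    N∉B : N ∉ B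
    N∉B with proj₁ (proj₂ split-unique)
    ... | N∉ ∷ _ = All¬⇒¬Any N∉

    A≤n : ∀ {v} → v ∈ A → v ≤ n
    A≤n m = below-N (inA m) (λ { refl → A∩NB=∅ m (here refl) })

    B≤n : ∀ {u} → u ∈ B → u ≤ n
    B≤n m = below-N (inB m) (λ { refl → N∉B m })

    B<A : ∀ {v u} → v ∈ A → u ∈ B → u < v
    B<A {v} {u} v∈ u∈ with <-cmp u v
    ... | tri< u<v _ _ = u<v
    ... | tri≈ _ refl _ = ⊥-elim (A∩NB=∅ v∈ (there u∈))
    ... | tri> _ _ v<u = ⊥-elim (¬has132 (v , N , u , ++⁺ (from∈ v∈) (refl ∷ from∈ u∈) , v<u , s≤s (B≤n u∈)))

    private
      b : ℕ
      b = length B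

    B-downClosed : ∀ {u t} → u ∈ B → 1 ≤ t → t ≤ u → t ∈ B
    B-downClosed {u} {t} u∈ 1≤t t≤u with ∈-++⁻ A (onto 1≤t (≤-trans t≤u (m≤n⇒m≤1+n (B≤n u∈))))
    ... | inj₁ t∈A = ⊥-elim (≤⇒≯ t≤u (B<A t∈A u∈))
    ... | inj₂ (here refl) = ⊥-elim (≤⇒≯ t≤u (s≤s (B≤n u∈)))
    ... | inj₂ (there t∈B) = t∈B

    B≤b : ∀ {v} → v ∈ B → v ≤ b
    B≤b {v} v∈ with v ≤? b
    ... | yes v≤b = v≤b
    ... | no v≰b = ⊥-elim (<⇒≱ (≰⇒> v≰b) (subst (_≤ b) (length-inc v)
            (⊆⇒length≤ (inc v) B (Unique-inc v) (λ m → let (1≤t , t≤v) = ∈-inc⁻ m in B-downClosed v∈ 1≤t t≤v))))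

    B-onto : ∀ {v} → 1 ≤ v → v ≤ b → v ∈ B
    B-onto {suc v} 1≤v v≤b with suc v ∈? B
    ... | yes v∈ = v∈
    ... | no v∉ = ⊥-elim (<⇒≱ v≤b (subst (b ≤_) (length-inc v)
            (⊆⇒length≤ B (inc v) uB (λ {u} m → ∈-inc⁺ (proj₁ (inRange (inB m))) (≤-pred (below-v m))))))
      where
      below-v : ∀ {u} → u ∈ B → u < suc v
      below-v {u} m with <-cmp u (suc v)
      ... | tri< u<v _ _ = u<v
      ... | tri≈ _ refl _ = ⊥-elim (v∉ m)
      ... | tri> _ _ v<u = ⊥-elim (v∉ (B-downClosed m 1≤v (<⇒≤ v<u)))

    b≤n : b ≤ n
    b≤n = subst (b ≤_) (length-inc n) (⊆⇒length≤ B (inc n) uB (λ m → ∈-inc⁺ (proj₁ (inRange (inB m))) (B≤n m)))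

    b<A : ∀ {v} → v ∈ A → b < v
    b<A {v} m with b <? v
    ... | yes b<v = b<v
    ... | no b≮v = ⊥-elim (A∩NB=∅ m (there (B-onto (proj₁ (inRange (inA m))) (≮⇒≥ b≮v))))

    A-onto : ∀ {v} → b < v → v ≤ n → v ∈ A
    A-onto {v} b<v v≤n with ∈-++⁻ A (onto (≤-trans (s≤s z≤n) b<v) (m≤n⇒m≤1+n v≤n))
    ... | inj₁ m = m
    ... | inj₂ (here refl) = ⊥-elim (<-irrefl refl (s≤s v≤n))
    ... | inj₂ (there m) = ⊥-elim (<⇒≱ b<v (B≤b m))

    α : List ℕ
    α = map (_∸ b) A

    α+b≡A : map (_+ b) α ≡ A
    α+b≡A = trans (sym (map-∘ A)) (map-id-local (All.tabulate (λ m → m∸n+n≡m (<⇒≤ (b<A m)))))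

    α-isPermutation : IsPermutation (n ∸ b) α
    α-isPermutation = unique , range , onto′
      where
      unique : Unique α
      unique = Unique-map (_∸ b) A uA
        (λ m₁ m₂ e → trans (sym (m∸n+n≡m (<⇒≤ (b<A m₁)))) (trans (cong (_+ b) e) (m∸n+n≡m (<⇒≤ (b<A m₂)))))
      range : ∀ {v} → v ∈ α → 1 ≤ v × v ≤ n ∸ b
      range m with ∈-map⁻ (_∸ b) m
      ... | x , x∈ , refl = subst (_≤ x ∸ b) (m+n∸n≡m 1 b) (∸-monoˡ-≤ b (b<A x∈)) , ∸-monoˡ-≤ b (A≤n x∈)
      onto′ : ∀ {v} → 1 ≤ v → v ≤ n ∸ b → v ∈ α
      onto′ {v} 1≤v v≤n∸b = subst (_∈ α) (m+n∸n≡m v b) (∈-map⁺ (_∸ b) (A-onto (+-monoˡ-≤ b 1≤v)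
        (subst (v + b ≤_) (m∸n+n≡m b≤n) (+-monoˡ-≤ b v≤n∸b))))

    α-avoids132 : avoids p132 α ≡ true
    α-avoids132 = avoids132⁺ α λ has →
      let (x , y , z , p , x<z , z<y) = subst Has132 α+b≡A
            (contains132⁻ _ (trans (contains-map (_+ b) (+-strictlyMonotoneᵇ b) p132 α) (contains132⁺ α has)))
      in ¬has132 (x , y , z , ++⁺ʳ (N ∷ B) p , x<z , z<y)

    B-avoids132 : avoids p132 B ≡ true
    B-avoids132 = avoids132⁺ B λ (x , y , z , p , x<z , z<y) → ¬has132 (x , y , z , ++⁺ˡ A (N ∷ʳ p) , x<z , z<y)

    ∈-gluings : w ∈ gluings n
    ∈-gluings = subst (_∈ gluings n) glue≡w
      (∈-concatMap⁺′ (gluingsAt n) (∈-zeroTo⁺ n (m∸n≤m n b))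
        (∈-concatMap⁺′ (λ α → map (glue (n ∸ a) N α) (Av132 (n ∸ a))) (∈-Av132 α-isPermutation α-avoids132)
          (∈-map⁺ (glue (n ∸ a) N α) B∈)))
      where
      a : ℕ
      a = n ∸ b
      n∸a≡b : n ∸ a ≡ b
      n∸a≡b = m∸[m∸n]≡n b≤n
      B∈ : B ∈ Av132 (n ∸ a)
      B∈ = subst (λ t → B ∈ Av132 t) (sym n∸a≡b) (∈-Av132 (uB , (λ m → proj₁ (inRange (inB m)) , B≤b m) , B-onto) B-avoids132)
      glue≡w : glue (n ∸ a) N α B ≡ w
      glue≡w = trans (cong (λ t → glue t N α B) n∸a≡b) (cong (_++ N ∷ B) α+b≡A)

  Av132-⊆-gluings : ∀ n {w} → w ∈ Av132 (suc n) → w ∈ gluings n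
  Av132-⊆-gluings n {w} w∈ with ∈-∃++ (proj₂ (proj₂ (Av132-isPermutation {suc n} w∈)) {suc n} (s≤s z≤n) ≤-refl)
  ... | A , B , refl = SplitAvoider.∈-gluings A B (Av132-isPermutation {suc n} w∈) (Av132-avoids {suc n} w∈)

  count132-suc : (r p q : List ℕ → Bool) (n : ℕ) →
    (∀ {a α β} → a ≤ n → α ∈ Av132 a → β ∈ Av132 (n ∸ a) → r (glue (n ∸ a) (suc n) α β) ≡ p α ∧ q β) →
    count132 r (suc n) ≡ sumℕ n (λ a → count132 p a * count132 q (n ∸ a))
  count132-suc r p q n factor =
    trans (length-filterᵇ-≡ r (Av132 (suc n)) (gluings n) (Unique-Av132 (suc n)) (Unique-gluings n)
                            (Av132-⊆-gluings n) (gluings-⊆-Av132 n))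
          (length-filterᵇ-gluings r p q n factor)

module Alternation where

  open import Defs
  open BooleanReflection
  open import Data.Bool using (Bool; true; false; _∧_; not; if_then_else_)
  open import Data.Bool.Properties using (not-involutive)
  open import Data.Nat using (ℕ; zero; suc; _+_; _<_; _<ᵇ_; _≤ᵇ_)
  open import Data.Nat.Properties using (<-asym; +-suc)
  open import Data.List using (List; []; _∷_; _++_; length)
  open import Data.List.Properties using (length-++)
  open import Data.List.Membership.Propositional using (_∈_)
  open import Data.List.Relation.Unary.Any using (here; there)
  open import Relation.Binary.PropositionalEquality using (_≡_; refl; trans; cong)

  flips : Bool → ℕ → Bool
  flips s zero = s
  flips s (suc j) = not (flips s j)

  flips-not : ∀ s j → flips (not s) j ≡ not (flips s j)
  flips-not s zero = refl
  flips-not s (suc j) = cong not (flips-not s j)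

  flips-true : ∀ m → flips true m ≡ isEven m
  flips-true zero = refl
  flips-true (suc zero) = refl
  flips-true (suc (suc m)) = trans (not-involutive _) (flips-true m)

  flips-false : ∀ m → flips false m ≡ not (isEven m)
  flips-false m = trans (flips-not true m) (cong not (flips-true m))

  isEven-suc : ∀ m → isEven (suc m) ≡ not (isEven m)
  isEven-suc zero = refl
  isEven-suc (suc zero) = refl
  isEven-suc (suc (suc m)) = isEven-suc m

  isEven-+ : ∀ m n → isEven (m + n) ≡ beq (isEven m) (isEven n)
  isEven-+ zero n with isEven n
  ... | true = refl
  ... | false = refl
  isEven-+ (suc m) n rewrite isEven-suc (m + n) | isEven-suc m | isEven-+ m n with isEven m | isEven n
  ... | true | true = refl
  ... | true | false = refl
  ... | false | _ = refl

  intoMax : Bool → List ℕ → Bool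
  intoMax s [] = true
  intoMax s (a ∷ A) = altFrom s (a ∷ A) ∧ flips s (length A)

  outOfMax : Bool → List ℕ → Bool
  outOfMax d [] = true
  outOfMax d (b ∷ B) = not d ∧ altFrom true (b ∷ B)

  AllBelow : ℕ → List ℕ → Set
  AllBelow N A = ∀ {v} → v ∈ A → v < N

  altFrom-max∷ : ∀ d N B → AllBelow N B → altFrom d (N ∷ B) ≡ outOfMax d B
  altFrom-max∷ d N [] B<N = refl
  altFrom-max∷ true N (b ∷ B) B<N rewrite <ᵇ-false {N} {b} (<-asym (B<N (here refl))) = refl
  altFrom-max∷ false N (b ∷ B) B<N rewrite <ᵇ-true {b} {N} (B<N (here refl)) = refl

  altFrom-max : ∀ s A N B → AllBelow N A → AllBelow N B →
    altFrom s (A ++ N ∷ B) ≡ intoMax s A ∧ outOfMax (flips s (length A)) B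
  altFrom-max s [] N B A<N B<N = altFrom-max∷ s N B B<N
  altFrom-max true (a ∷ []) N B A<N B<N rewrite <ᵇ-true {a} {N} (A<N (here refl)) = altFrom-max∷ false N B B<N
  altFrom-max false (a ∷ []) N B A<N B<N rewrite <ᵇ-false {N} {a} (<-asym (A<N (here refl))) = refl
  altFrom-max s (a ∷ a′ ∷ A) N B A<N B<N
    rewrite altFrom-max (not s) (a′ ∷ A) N B (λ m → A<N (there m)) B<N | flips-not s (length A)
    = ∧-assoc₄ (if s then a <ᵇ a′ else a′ <ᵇ a) _ _ _
    where
    ∧-assoc₄ : ∀ c X F R → c ∧ ((X ∧ F) ∧ R) ≡ ((c ∧ X) ∧ F) ∧ R
    ∧-assoc₄ true X F R = refl
    ∧-assoc₄ false X F R = refl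

  oddUp evenUp evenDown : List ℕ → Bool
  oddUp w = not (isEven (length w)) ∧ altFrom true w
  evenUp w = isEven (length w) ∧ altFrom true w
  evenDown w = isEven (length w) ∧ altFrom false w

  length-++-∷ : ∀ (A : List ℕ) N B → length (A ++ N ∷ B) ≡ suc (length A + length B)
  length-++-∷ A N B = trans (length-++ A) (+-suc (length A) (length B))

  isUpDown-max : ∀ A N B → AllBelow N A → AllBelow N B → isUpDown (A ++ N ∷ B) ≡ oddUp A ∧ oddUp B
  isUpDown-max [] N [] A<N B<N rewrite altFrom-max true [] N [] A<N B<N = refl
  isUpDown-max [] N (b ∷ B′) A<N B<N rewrite altFrom-max true [] N (b ∷ B′) A<N B<N with isEven (length B′)
  ... | true = refl
  ... | false = refl
  isUpDown-max (a ∷ A′) N [] A<N B<N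
    rewrite altFrom-max true (a ∷ A′) N [] A<N B<N
          | length-++-∷ A′ N []
          | isEven-+ (length A′) 0
          | isEven-suc (length A′)
          | flips-true (length A′)
    with isEven (length A′) | altFrom true (a ∷ A′)
  ... | true | true = refl
  ... | true | false = refl
  ... | false | true = refl
  ... | false | false = refl
  isUpDown-max (a ∷ A′) N (b ∷ B′) A<N B<N
    rewrite altFrom-max true (a ∷ A′) N (b ∷ B′) A<N B<N
          | length-++-∷ A′ N (b ∷ B′)
          | isEven-+ (length A′) (length (b ∷ B′))
          | isEven-suc (length A′)
          | isEven-suc (length B′)
          | flips-true (length A′)
    with isEven (length A′) | altFrom true (a ∷ A′) | isEven (length B′)
  ... | true | true | true = refl
  ... | true | true | false = refl
  ... | true | false | true = refl
  ... | true | false | false = refl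
  ... | false | true | true = refl
  ... | false | true | false = refl
  ... | false | false | true = refl
  ... | false | false | false = refl

  isUpUp-max : ∀ A N B → AllBelow N A → AllBelow N B → isUpUp (A ++ N ∷ B) ≡ oddUp A ∧ evenUp B
  isUpUp-max [] N [] A<N B<N rewrite altFrom-max true [] N [] A<N B<N = refl
  isUpUp-max [] N (b ∷ B′) A<N B<N rewrite altFrom-max true [] N (b ∷ B′) A<N B<N with isEven (length B′)
  ... | true = refl
  ... | false = refl
  isUpUp-max (a ∷ A′) N [] A<N B<N
    rewrite altFrom-max true (a ∷ A′) N [] A<N B<N
          | length-++-∷ A′ N []
          | isEven-+ (length A′) 0
          | isEven-suc (length A′)
          | flips-true (length A′)
    with isEven (length A′) | altFrom true (a ∷ A′)
  ... | true | true = refl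
  ... | true | false = refl
  ... | false | _ = refl
  isUpUp-max (a ∷ A′) N (b ∷ B′) A<N B<N
    rewrite altFrom-max true (a ∷ A′) N (b ∷ B′) A<N B<N
          | length-++-∷ A′ N (b ∷ B′)
          | isEven-+ (length A′) (length (b ∷ B′))
          | isEven-suc (length A′)
          | isEven-suc (length B′)
          | flips-true (length A′)
    with isEven (length A′) | altFrom true (a ∷ A′) | isEven (length B′)
  ... | true | true | true = refl
  ... | true | true | false = refl
  ... | true | false | true = refl
  ... | true | false | false = refl
  ... | false | true | true = refl
  ... | false | true | false = refl
  ... | false | false | true = refl
  ... | false | false | false = refl

  isDownDown-max : ∀ A N B → AllBelow N A → AllBelow N B → isDownDown (A ++ N ∷ B) ≡ evenDown A ∧ oddUp B
  isDownDown-max [] N [] A<N B<N rewrite altFrom-max false [] N [] A<N B<N = refl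
  isDownDown-max [] N (b ∷ B′) A<N B<N
    rewrite altFrom-max false [] N (b ∷ B′) A<N B<N
          | isEven-suc (length B′)
    with isEven (length B′)
  ... | true = refl
  ... | false = refl
  isDownDown-max (a ∷ A′) N [] A<N B<N
    rewrite altFrom-max false (a ∷ A′) N [] A<N B<N
          | length-++-∷ A′ N []
          | isEven-+ (length A′) 0
          | isEven-suc (length A′)
          | flips-false (length A′)
    with isEven (length A′) | altFrom false (a ∷ A′)
  ... | true | true = refl
  ... | true | false = refl
  ... | false | true = refl
  ... | false | false = refl
  isDownDown-max (a ∷ A′) N (b ∷ B′) A<N B<N
    rewrite altFrom-max false (a ∷ A′) N (b ∷ B′) A<N B<N
          | length-++-∷ A′ N (b ∷ B′)
          | isEven-+ (length A′) (length (b ∷ B′))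
          | isEven-suc (length A′)
          | isEven-suc (length B′)
          | flips-false (length A′)
    with isEven (length A′) | altFrom false (a ∷ A′) | isEven (length B′)
  ... | true | true | true = refl
  ... | true | true | false = refl
  ... | true | false | true = refl
  ... | true | false | false = refl
  ... | false | true | _ = refl
  ... | false | false | true = refl
  ... | false | false | false = refl

  isDownUp-max : ∀ A N B → AllBelow N A → AllBelow N B →
    isDownUp (A ++ N ∷ B) ≡ (evenDown A ∧ evenUp B) ∧ (1 ≤ᵇ (length A + length B))
  isDownUp-max [] N [] A<N B<N rewrite altFrom-max false [] N [] A<N B<N = refl
  isDownUp-max [] N (b ∷ B′) A<N B<N
    rewrite altFrom-max false [] N (b ∷ B′) A<N B<N
          | isEven-suc (length B′)
    with isEven (length B′) | altFrom true (b ∷ B′)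
  ... | true | _ = refl
  ... | false | true = refl
  ... | false | false = refl
  isDownUp-max (a ∷ A′) N [] A<N B<N
    rewrite altFrom-max false (a ∷ A′) N [] A<N B<N
          | length-++-∷ A′ N []
          | isEven-+ (length A′) 0
          | isEven-suc (length A′)
          | flips-false (length A′)
    with isEven (length A′)
  ... | true = refl
  ... | false = refl
  isDownUp-max (a ∷ A′) N (b ∷ B′) A<N B<N
    rewrite altFrom-max false (a ∷ A′) N (b ∷ B′) A<N B<N
          | length-++-∷ A′ N (b ∷ B′)
          | isEven-+ (length A′) (length (b ∷ B′))
          | isEven-suc (length A′)
          | isEven-suc (length B′)
          | flips-false (length A′)
    with isEven (length A′) | altFrom false (a ∷ A′) | isEven (length B′) | altFrom true (b ∷ B′)
  ... | true | true | true | _ = refl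
  ... | true | true | false | _ = refl
  ... | true | false | true | _ = refl
  ... | true | false | false | _ = refl
  ... | false | true | true | _ = refl
  ... | false | true | false | true = refl
  ... | false | true | false | false = refl
  ... | false | false | true | _ = refl
  ... | false | false | false | _ = refl

module Recurrences where

  open import Defs
  open Lists
  open Patterns
  open Splitting
  open Alternation
  open MaxDecomposition
  open import Data.Bool using (Bool; true; false; _∧_; not)
  open import Data.Bool.Properties using (∧-commutativeMonoid; ∧-zeroʳ; ∧-identityʳ)
  open import Data.Nat using (ℕ; suc; _+_; _*_; _∸_; _≤_; _≤ᵇ_)
  open import Data.Nat.Properties using (m+[n∸m]≡n; ≤⇒≤ᵇ)
  open import Data.List using (List; []; _∷_; map; _++_; length)
  open import Data.List.Properties using (length-map)
  open import Data.List.Membership.Propositional using (_∈_)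
  open import Data.Product using (proj₁; proj₂)
  open import Algebra.Bundles using (CommutativeMonoid)
  open import Algebra.Properties.CommutativeSemigroup (CommutativeMonoid.commutativeSemigroup ∧-commutativeMonoid)
    using (interchange; x∙yz≈y∙xz)
  open BooleanReflection using (T⇒≡)
  open import Relation.Binary.PropositionalEquality using (_≡_; _≢_; refl; trans; cong; cong₂)

  altFrom-map : (f : ℕ → ℕ) → StrictlyMonotoneᵇ f → ∀ s w → altFrom s (map f w) ≡ altFrom s w
  altFrom-map f mono s [] = refl
  altFrom-map f mono s (a ∷ []) = refl
  altFrom-map f mono true (a ∷ b ∷ w) = cong₂ _∧_ (mono a b) (altFrom-map f mono false (b ∷ w))
  altFrom-map f mono false (a ∷ b ∷ w) = cong₂ _∧_ (mono b a) (altFrom-map f mono true (b ∷ w))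

  alternating-+ : ∀ (e : Bool → Bool) s b w →
    e (isEven (length (map (_+ b) w))) ∧ altFrom s (map (_+ b) w) ≡ e (isEven (length w)) ∧ altFrom s w
  alternating-+ e s b w = cong₂ (λ l a → e (isEven l) ∧ a) (length-map (_+ b) w) (altFrom-map (_+ b) (+-strictlyMonotoneᵇ b) s w)

  avoiding : ℕ → (List ℕ → Bool) → List ℕ → Bool
  avoiding k cls w = cls w ∧ avoids (inc k) w

  module _ (k n : ℕ) {a : ℕ} {α β : List ℕ} (a≤n : a ≤ n) (α∈ : α ∈ Av132 a) (β∈ : β ∈ Av132 (n ∸ a)) where

    private
      b : ℕ
      b = n ∸ a
      A : List ℕ
      A = map (_+ b) α
      split : SplitAtMax A (suc n) β
      split = glue-splitAtMax n a α β a≤n α∈ β∈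
      A<N : AllBelow (suc n) A
      A<N = proj₁ (proj₂ split)
      β<N : AllBelow (suc n) β
      β<N = proj₂ (proj₂ split)

    avoiding-glue : (cls l r : List ℕ → Bool) → l A ≡ l α → cls (A ++ suc n ∷ β) ≡ l A ∧ r β →
      avoiding (suc k) cls (glue b (suc n) α β) ≡ avoiding k l α ∧ avoiding (suc k) r β
    avoiding-glue cls l r l-shift cls-split =
      trans (cong₂ _∧_ (trans cls-split (cong (_∧ r β) l-shift))
                       (trans (avoids-inc-split A (suc n) β k split) (cong (_∧ avoids (inc (suc k)) β) (avoids-+ b (inc k) α))))
            (interchange (l α) (r β) (avoids (inc k) α) (avoids (inc (suc k)) β))

    glue-upDown : avoiding (suc k) isUpDown (glue b (suc n) α β) ≡ avoiding k oddUp α ∧ avoiding (suc k) oddUp β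
    glue-upDown = avoiding-glue isUpDown oddUp oddUp (alternating-+ not true b α) (isUpDown-max A (suc n) β A<N β<N)

    glue-upUp : avoiding (suc k) isUpUp (glue b (suc n) α β) ≡ avoiding k oddUp α ∧ avoiding (suc k) evenUp β
    glue-upUp = avoiding-glue isUpUp oddUp evenUp (alternating-+ not true b α) (isUpUp-max A (suc n) β A<N β<N)

    glue-downDown : avoiding (suc k) isDownDown (glue b (suc n) α β) ≡ avoiding k evenDown α ∧ avoiding (suc k) oddUp β
    glue-downDown = avoiding-glue isDownDown evenDown oddUp (alternating-+ (λ e → e) false b α) (isDownDown-max A (suc n) β A<N β<N)

    glue-downUp : 1 ≤ n → avoiding (suc k) isDownUp (glue b (suc n) α β) ≡ avoiding k evenDown α ∧ avoiding (suc k) evenUp β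
    glue-downUp 1≤n = avoiding-glue isDownUp evenDown evenUp (alternating-+ (λ e → e) false b α)
      (trans (isDownUp-max A (suc n) β A<N β<N) (trans (cong ((evenDown A ∧ evenUp β) ∧_) nonempty) (∧-identityʳ _)))
      where
      nonempty : (1 ≤ᵇ (length A + length β)) ≡ true
      nonempty = trans (cong (1 ≤ᵇ_) (trans (cong₂ _+_ (trans (length-map _ α) (Av132-length {a} α∈)) (Av132-length {n ∸ a} β∈)) (m+[n∸m]≡n a≤n)))
                       (T⇒≡ (≤⇒≤ᵇ 1≤n))

  recurrence-upDown : ∀ k n → count132 (avoiding (suc k) isUpDown) (suc n)
                            ≡ sumℕ n (λ a → count132 (avoiding k oddUp) a * count132 (avoiding (suc k) oddUp) (n ∸ a))
  recurrence-upDown k n = count132-suc _ _ _ n (glue-upDown k n)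

  recurrence-upUp : ∀ k n → count132 (avoiding (suc k) isUpUp) (suc n)
                          ≡ sumℕ n (λ a → count132 (avoiding k oddUp) a * count132 (avoiding (suc k) evenUp) (n ∸ a))
  recurrence-upUp k n = count132-suc _ _ _ n (glue-upUp k n)

  recurrence-downDown : ∀ k n → count132 (avoiding (suc k) isDownDown) (suc n)
                              ≡ sumℕ n (λ a → count132 (avoiding k evenDown) a * count132 (avoiding (suc k) oddUp) (n ∸ a))
  recurrence-downDown k n = count132-suc _ _ _ n (glue-downDown k n)

  recurrence-downUp : ∀ k n → 1 ≤ n → count132 (avoiding (suc k) isDownUp) (suc n)
                            ≡ sumℕ n (λ a → count132 (avoiding k evenDown) a * count132 (avoiding (suc k) evenUp) (n ∸ a))
  recurrence-downUp k n 1≤n = count132-suc _ _ _ n (λ a≤n α∈ β∈ → glue-downUp k n a≤n α∈ β∈ 1≤n)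

  countAv≡count132 : ∀ (cls : List ℕ → Bool) k m → countAv cls k m ≡ count132 (avoiding k cls) m
  countAv≡count132 cls k m = cong length (trans
    (filterᵇ-cong _ _ (perms m) (λ {w} _ → x∙yz≈y∙xz (cls w) (avoids p132 w) (avoids (inc k) w)))
    (filterᵇ-∧ (avoids p132) (avoiding k cls) (perms m)))

  count132-cong : ∀ (p q : List ℕ → Bool) m → (∀ w → length w ≡ m → p w ≡ q w) → count132 p m ≡ count132 q m
  count132-cong p q m p≡q = cong length (filterᵇ-cong p q (Av132 m) (λ {w} w∈ → p≡q w (Av132-length w∈)))

  oddUp≡isUpDown : ∀ w → length w ≢ 1 → oddUp w ≡ isUpDown w
  oddUp≡isUpDown [] _ = refl
  oddUp≡isUpDown (a ∷ []) ≢1 with ≢1 refl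
  ... | ()
  oddUp≡isUpDown (a ∷ b ∷ w) _ = refl

  evenUp≡isUpUp : ∀ w → length w ≢ 0 → evenUp w ≡ isUpUp w
  evenUp≡isUpUp [] ≢0 with ≢0 refl
  ... | ()
  evenUp≡isUpUp (a ∷ []) _ = refl
  evenUp≡isUpUp (a ∷ b ∷ w) _ = refl

  evenDown≡isDownDown : ∀ w → length w ≢ 0 → evenDown w ≡ isDownDown w
  evenDown≡isDownDown [] ≢0 with ≢0 refl
  ... | ()
  evenDown≡isDownDown (a ∷ []) _ = refl
  evenDown≡isDownDown (a ∷ b ∷ w) _ = refl

  count132-avoiding-0 : ∀ cls m → count132 (avoiding 0 cls) m ≡ 0
  count132-avoiding-0 cls m = trans (count132-cong _ (λ _ → false) m (λ w _ → avoiding-0 w)) (length-filterᵇ-false (Av132 m))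
    where
    avoiding-0 : ∀ w → avoiding 0 cls w ≡ false
    avoiding-0 [] = ∧-zeroʳ (cls [])
    avoiding-0 (v ∷ w) = ∧-zeroʳ (cls (v ∷ w))

module PowerSeries where

  open import Defs
  open BooleanReflection using (≡ᵇ-refl; ≡ᵇ-false)
  open import Data.Nat as ℕ using (ℕ; zero; suc; _∸_; _≤_; _<_; z≤n)
  import Data.Nat.Properties as ℕ
  open import Data.Rational using (ℚ; 0ℚ; 1ℚ; _+_; _*_)
  import Data.Rational.Properties as ℚ
  open import Data.Rational.Solver using (module +-*-Solver)
  open import Data.Product using (_,_)
  open import Data.Sum using (inj₁; inj₂)
  open import Data.Bool using (if_then_else_)
  open import Relation.Nullary using (yes; no)
  open import Algebra.Bundles using (CommutativeSemiring)
  open import Algebra.Structures using (IsCommutativeSemiring)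
  open import Algebra.Properties.Group ℚ.+-0-group using () renaming (∙-cancelˡ to +-cancelˡ; ∙-cancelʳ to +-cancelʳ)
  open import Relation.Binary.PropositionalEquality using (_≡_; _≢_; refl; sym; trans; cong; cong₂; subst)

  sumTo-cong : ∀ n {f g : ℕ → ℚ} → (∀ i → i ≤ n → f i ≡ g i) → sumTo n f ≡ sumTo n g
  sumTo-cong zero f≡g = f≡g 0 z≤n
  sumTo-cong (suc n) f≡g = cong₂ _+_ (sumTo-cong n (λ i i≤n → f≡g i (ℕ.m≤n⇒m≤1+n i≤n))) (f≡g (suc n) ℕ.≤-refl)

  sumTo-cong′ : ∀ n {f g : ℕ → ℚ} → (∀ i → f i ≡ g i) → sumTo n f ≡ sumTo n g
  sumTo-cong′ n f≡g = sumTo-cong n (λ i _ → f≡g i)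

  sumTo-+ : ∀ n (f g : ℕ → ℚ) → sumTo n (λ i → f i + g i) ≡ sumTo n f + sumTo n g
  sumTo-+ zero f g = refl
  sumTo-+ (suc n) f g rewrite sumTo-+ n f g = +-interchange (sumTo n f) (sumTo n g) (f (suc n)) (g (suc n))
    where
    open +-*-Solver
    +-interchange : ∀ a b c d → (a + b) + (c + d) ≡ (a + c) + (b + d)
    +-interchange = solve 4 (λ a b c d → (a :+ b) :+ (c :+ d) := (a :+ c) :+ (b :+ d)) refl

  *-sumToˡ : ∀ n c (f : ℕ → ℚ) → c * sumTo n f ≡ sumTo n (λ i → c * f i)
  *-sumToˡ zero c f = refl
  *-sumToˡ (suc n) c f = trans (ℚ.*-distribˡ-+ c (sumTo n f) (f (suc n))) (cong (_+ c * f (suc n)) (*-sumToˡ n c f))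

  *-sumToʳ : ∀ n c (f : ℕ → ℚ) → sumTo n f * c ≡ sumTo n (λ i → f i * c)
  *-sumToʳ n c f = trans (ℚ.*-comm (sumTo n f) c) (trans (*-sumToˡ n c f) (sumTo-cong′ n (λ i → ℚ.*-comm c (f i))))

  sumTo-0 : ∀ n → sumTo n (λ _ → 0ℚ) ≡ 0ℚ
  sumTo-0 zero = refl
  sumTo-0 (suc n) rewrite sumTo-0 n = refl

  sumTo-suc : ∀ n (f : ℕ → ℚ) → sumTo (suc n) f ≡ f 0 + sumTo n (λ i → f (suc i))
  sumTo-suc zero f = refl
  sumTo-suc (suc n) f rewrite sumTo-suc n f = ℚ.+-assoc (f 0) (sumTo n (λ i → f (suc i))) (f (suc (suc n)))

  sumTo-reverse : ∀ n (f : ℕ → ℚ) → sumTo n f ≡ sumTo n (λ i → f (n ∸ i))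
  sumTo-reverse zero f = refl
  sumTo-reverse (suc n) f = trans (cong (_+ f (suc n)) (sumTo-reverse n f))
    (trans (ℚ.+-comm (sumTo n (λ i → f (n ∸ i))) (f (suc n))) (sym (sumTo-suc n (λ i → f (suc n ∸ i)))))

  sumTo-triangle : ∀ n (F : ℕ → ℕ → ℚ) →
    sumTo n (λ m → sumTo m (λ i → F i m)) ≡ sumTo n (λ i → sumTo (n ∸ i) (λ j → F i (i ℕ.+ j)))
  sumTo-triangle zero F = refl
  sumTo-triangle (suc n) F = begin
    sumTo n (λ m → sumTo m (λ i → F i m)) + sumTo (suc n) (λ i → F i (suc n))
      ≡⟨ cong (_+ sumTo (suc n) (λ i → F i (suc n))) (sumTo-triangle n F) ⟩
    rows n + (column + F (suc n) (suc n))
      ≡⟨ sym (ℚ.+-assoc (rows n) column (F (suc n) (suc n))) ⟩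
    (rows n + column) + F (suc n) (suc n)
      ≡⟨ cong₂ _+_ (sym longer-rows) (cong (λ t → F (suc n) t) (sym (ℕ.+-identityʳ (suc n)))) ⟩
    sumTo n (λ i → sumTo (suc n ∸ i) (λ j → F i (i ℕ.+ j))) + F (suc n) (suc n ℕ.+ 0)
      ≡⟨ cong (λ t → sumTo n (λ i → sumTo (suc n ∸ i) (λ j → F i (i ℕ.+ j))) + sumTo t (λ j → F (suc n) (suc n ℕ.+ j)))
              (sym (ℕ.n∸n≡0 n)) ⟩
    sumTo (suc n) (λ i → sumTo (suc n ∸ i) (λ j → F i (i ℕ.+ j))) ∎
    where
    open Relation.Binary.PropositionalEquality.≡-Reasoning
    rows : ℕ → ℚ
    rows m = sumTo n (λ i → sumTo (m ∸ i) (λ j → F i (i ℕ.+ j)))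
    column : ℚ
    column = sumTo n (λ i → F i (suc n))
    longer-rows : sumTo n (λ i → sumTo (suc n ∸ i) (λ j → F i (i ℕ.+ j))) ≡ rows n + column
    longer-rows = trans (sumTo-cong n (λ i i≤n →
        trans (cong (λ t → sumTo t (λ j → F i (i ℕ.+ j))) (ℕ.+-∸-assoc 1 i≤n))
              (cong (sumTo (n ∸ i) (λ j → F i (i ℕ.+ j)) +_)
                    (cong (F i) (trans (ℕ.+-suc i (n ∸ i)) (cong suc (ℕ.m+[n∸m]≡n i≤n)))))))
      (sumTo-+ n _ _)

  0ₛ 1ₛ x : Series
  0ₛ _ = 0ℚ
  1ₛ = mono 0
  x = mono 1

  ⊛-comm : ∀ f g → f ⊛ g ≈ₛ g ⊛ f
  ⊛-comm f g n = trans (sumTo-reverse n _) (sumTo-cong n (λ i i≤n →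
    trans (ℚ.*-comm (f (n ∸ i)) (g (n ∸ (n ∸ i)))) (cong (λ t → g t * f (n ∸ i)) (ℕ.m∸[m∸n]≡n i≤n))))

  ⊛-assoc : ∀ f g h → (f ⊛ g) ⊛ h ≈ₛ f ⊛ (g ⊛ h)
  ⊛-assoc f g h n =
    trans (sumTo-cong′ n (λ m → *-sumToʳ m (h (n ∸ m)) (λ i → f i * g (m ∸ i))))
    (trans (sumTo-triangle n (λ i m → f i * g (m ∸ i) * h (n ∸ m)))
    (sumTo-cong′ n (λ i → trans (sumTo-cong′ (n ∸ i) (λ j →
         trans (cong₂ (λ u v → f i * g u * h v) (ℕ.m+n∸m≡n i j) (sym (ℕ.∸-+-assoc n i j))) (ℚ.*-assoc (f i) (g j) (h (n ∸ i ∸ j)))))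
       (sym (*-sumToˡ (n ∸ i) (f i) (λ j → g j * h (n ∸ i ∸ j)))))))

  ⊛-distribˡ-⊕ : ∀ f g h → f ⊛ (g ⊕ h) ≈ₛ (f ⊛ g) ⊕ (f ⊛ h)
  ⊛-distribˡ-⊕ f g h n = trans (sumTo-cong′ n (λ i → ℚ.*-distribˡ-+ (f i) _ _)) (sumTo-+ n _ _)

  ⊛-cong : ∀ {f f′ g g′} → f ≈ₛ f′ → g ≈ₛ g′ → f ⊛ g ≈ₛ f′ ⊛ g′
  ⊛-cong f≈f′ g≈g′ n = sumTo-cong′ n (λ i → cong₂ _*_ (f≈f′ i) (g≈g′ (n ∸ i)))

  ⊛-zeroˡ : ∀ f → 0ₛ ⊛ f ≈ₛ 0ₛ
  ⊛-zeroˡ f n = trans (sumTo-cong′ n (λ i → ℚ.*-zeroˡ (f (n ∸ i)))) (sumTo-0 n)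

  mono-≡ : ∀ d → mono d d ≡ 1ℚ
  mono-≡ d rewrite ≡ᵇ-refl d = refl

  mono-≢ : ∀ d i → i ≢ d → mono d i ≡ 0ℚ
  mono-≢ d i i≢d rewrite ≡ᵇ-false i≢d = refl

  sumTo-mono-< : ∀ d n (g : ℕ → ℚ) → n < d → sumTo n (λ i → mono d i * g i) ≡ 0ℚ
  sumTo-mono-< d zero g n<d = trans (cong (_* g 0) (mono-≢ d 0 (λ e → ℕ.<-irrefl e n<d))) (ℚ.*-zeroˡ (g 0))
  sumTo-mono-< d (suc n) g n<d = cong₂ _+_ (sumTo-mono-< d n g (ℕ.<-trans (ℕ.n<1+n n) n<d))
    (trans (cong (_* g (suc n)) (mono-≢ d (suc n) (λ e → ℕ.<-irrefl e n<d))) (ℚ.*-zeroˡ (g (suc n))))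

  sumTo-mono-≤ : ∀ d n (g : ℕ → ℚ) → d ≤ n → sumTo n (λ i → mono d i * g i) ≡ g d
  sumTo-mono-≤ zero zero g z≤n = trans (cong (_* g 0) (mono-≡ 0)) (ℚ.*-identityˡ (g 0))
  sumTo-mono-≤ d (suc n) g d≤n with ℕ.m≤n⇒m<n∨m≡n d≤n
  ... | inj₁ d<n = trans (cong₂ _+_ (sumTo-mono-≤ d n g (ℕ.≤-pred d<n))
          (trans (cong (_* g (suc n)) (mono-≢ d (suc n) (λ e → ℕ.<-irrefl (sym e) d<n))) (ℚ.*-zeroˡ (g (suc n)))))
          (ℚ.+-identityʳ (g d))
  ... | inj₂ refl = trans (cong₂ _+_ (sumTo-mono-< (suc n) n g ℕ.≤-refl)
          (trans (cong (_* g (suc n)) (mono-≡ (suc n))) (ℚ.*-identityˡ (g (suc n)))))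
          (ℚ.+-identityˡ (g (suc n)))

  mono-⊛-+ : ∀ d m f → (mono d ⊛ f) (d ℕ.+ m) ≡ f m
  mono-⊛-+ d m f = trans (sumTo-mono-≤ d (d ℕ.+ m) (λ i → f (d ℕ.+ m ∸ i)) (ℕ.m≤m+n d m)) (cong f (ℕ.m+n∸m≡n d m))

  mono-⊛-< : ∀ d n f → n < d → (mono d ⊛ f) n ≡ 0ℚ
  mono-⊛-< d n f n<d = sumTo-mono-< d n (λ i → f (n ∸ i)) n<d

  ⊛-identityˡ : ∀ f → 1ₛ ⊛ f ≈ₛ f
  ⊛-identityˡ f n = mono-⊛-+ 0 n f

  mono-+ : ∀ a b → mono (a ℕ.+ b) ≈ₛ mono a ⊛ mono b
  mono-+ a b n with a ℕ.≤? n
  ... | yes a≤n = subst (λ t → mono (a ℕ.+ b) t ≡ (mono a ⊛ mono b) t) (ℕ.m+[n∸m]≡n a≤n) (shifted (n ∸ a))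
    where
    ≡ᵇ-+ : ∀ a m → ((a ℕ.+ m) ℕ.≡ᵇ (a ℕ.+ b)) ≡ (m ℕ.≡ᵇ b)
    ≡ᵇ-+ zero m = refl
    ≡ᵇ-+ (suc a) m = ≡ᵇ-+ a m
    shifted : ∀ m → mono (a ℕ.+ b) (a ℕ.+ m) ≡ (mono a ⊛ mono b) (a ℕ.+ m)
    shifted m = trans (cong (λ t → if t then 1ℚ else 0ℚ) (≡ᵇ-+ a m)) (sym (mono-⊛-+ a m (mono b)))
  ... | no a≰n = trans (mono-≢ (a ℕ.+ b) n (λ n≡a+b → a≰n (subst (a ≤_) (sym n≡a+b) (ℕ.m≤m+n a b))))
                       (sym (mono-⊛-< a n (mono b) (ℕ.≰⇒> a≰n)))

  ⊛-identityʳ : ∀ f → f ⊛ 1ₛ ≈ₛ f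
  ⊛-identityʳ f n = trans (⊛-comm f 1ₛ n) (⊛-identityˡ f n)

  -- Opaque copies of _⊕_ and _⊛_: the semiring solver and the congruence lemmas must infer
  -- series from equations between products, which fails once products unfold to sums.
  opaque
    infixl 6 _+ₛ_
    infixl 7 _*ₛ_
    _+ₛ_ _*ₛ_ : Series → Series → Series
    _+ₛ_ = _⊕_
    _*ₛ_ = _⊛_

  opaque
    unfolding _+ₛ_ _*ₛ_

    +ₛ≈⊕ : ∀ f g → f +ₛ g ≈ₛ f ⊕ g
    +ₛ≈⊕ f g n = refl

    *ₛ≈⊛ : ∀ f g → f *ₛ g ≈ₛ f ⊛ g
    *ₛ≈⊛ f g n = refl

    series-isCommutativeSemiring : IsCommutativeSemiring _≈ₛ_ _+ₛ_ _*ₛ_ 0ₛ 1ₛ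
    series-isCommutativeSemiring = record
      { isSemiring = record
        { isSemiringWithoutAnnihilatingZero = record
          { +-isCommutativeMonoid = record
            { isMonoid = record
              { isSemigroup = record
                { isMagma = record
                  { isEquivalence = record
                    { refl = λ _ → refl ; sym = λ e n → sym (e n) ; trans = λ e e′ n → trans (e n) (e′ n) }
                  ; ∙-cong = λ e e′ n → cong₂ _+_ (e n) (e′ n) }
                ; assoc = λ f g h n → ℚ.+-assoc (f n) (g n) (h n) }
              ; identity = (λ f n → ℚ.+-identityˡ (f n)) , (λ f n → ℚ.+-identityʳ (f n)) }
            ; comm = λ f g n → ℚ.+-comm (f n) (g n) }
          ; *-cong = ⊛-cong
          ; *-assoc = ⊛-assoc
          ; *-identity = ⊛-identityˡ , ⊛-identityʳ
          ; distrib = ⊛-distribˡ-⊕ , λ f g h n → trans (⊛-comm (g ⊕ h) f n)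
               (trans (⊛-distribˡ-⊕ f g h n) (cong₂ _+_ (⊛-comm f g n) (⊛-comm f h n))) }
        ; zero = ⊛-zeroˡ , λ f n → trans (⊛-comm f 0ₛ n) (⊛-zeroˡ f n) }
      ; *-comm = ⊛-comm }

  series-commutativeSemiring : CommutativeSemiring _ _
  series-commutativeSemiring = record { isCommutativeSemiring = series-isCommutativeSemiring }

  +ₛ-cancelʳ : ∀ f g h → f +ₛ h ≈ₛ g +ₛ h → f ≈ₛ g
  +ₛ-cancelʳ f g h e n = +-cancelʳ (h n) (f n) (g n) (trans (sym (+ₛ≈⊕ f h n)) (trans (e n) (+ₛ≈⊕ g h n)))

  *ₛ-cancelʳ : ∀ f g p → p 0 ≡ 1ℚ → f *ₛ p ≈ₛ g *ₛ p → f ≈ₛ g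
  *ₛ-cancelʳ f g p p₀≡1 e′ n = agree n n ℕ.≤-refl
    where
    e : f ⊛ p ≈ₛ g ⊛ p
    e n = trans (sym (*ₛ≈⊛ f p n)) (trans (e′ n) (*ₛ≈⊛ g p n))
    agree : ∀ n i → i ≤ n → f i ≡ g i
    agree zero .zero z≤n = begin
      f 0          ≡⟨ sym (ℚ.*-identityʳ (f 0)) ⟩
      f 0 * 1ℚ     ≡⟨ cong (f 0 *_) (sym p₀≡1) ⟩
      (f ⊛ p) 0    ≡⟨ e 0 ⟩
      (g ⊛ p) 0    ≡⟨ cong (g 0 *_) p₀≡1 ⟩
      g 0 * 1ℚ     ≡⟨ ℚ.*-identityʳ (g 0) ⟩
      g 0          ∎
      where open Relation.Binary.PropositionalEquality.≡-Reasoning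
    agree (suc n) i i≤1+n with ℕ.m≤n⇒m<n∨m≡n i≤1+n
    ... | inj₁ i<1+n = agree n i (ℕ.≤-pred i<1+n)
    ... | inj₂ refl = begin
      f (suc n)             ≡⟨ sym (ℚ.*-identityʳ (f (suc n))) ⟩
      f (suc n) * 1ℚ        ≡⟨ cong (f (suc n) *_) (sym p-last) ⟩
      f (suc n) * p (n ∸ n) ≡⟨ +-cancelˡ (lower-terms f) _ _ (trans (e (suc n)) (cong (_+ g (suc n) * p (n ∸ n)) (sym lower-agree))) ⟩
      g (suc n) * p (n ∸ n) ≡⟨ cong (g (suc n) *_) p-last ⟩
      g (suc n) * 1ℚ        ≡⟨ ℚ.*-identityʳ (g (suc n)) ⟩
      g (suc n)             ∎
      where
      open Relation.Binary.PropositionalEquality.≡-Reasoning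
      p-last : p (n ∸ n) ≡ 1ℚ
      p-last = trans (cong p (ℕ.n∸n≡0 n)) p₀≡1
      lower-terms : Series → ℚ
      lower-terms h = sumTo n (λ i → h i * p (suc n ∸ i))
      lower-agree : lower-terms f ≡ lower-terms g
      lower-agree = sumTo-cong n (λ i i≤n → cong (_* p (suc n ∸ i)) (agree n i i≤n))

module Chebyshev where

  open import Defs
  open BooleanReflection using (≤ᵇ-true; ≤ᵇ-false)
  open PowerSeries
  open import Data.Bool using (if_then_else_)
  open import Data.Nat as ℕ using (ℕ; zero; suc; _∸_; _≤_; z≤n; s≤s; _≤ᵇ_)
  import Data.Nat.Properties as ℕ
  open import Data.Integer as ℤ using (ℤ; +_; -[1+_])
  import Data.Integer.Properties as ℤ
  open import Data.Rational using (ℚ; 0ℚ; 1ℚ; _+_; _*_; -_; _/_; ½; mkℚ)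
  import Data.Rational.Properties as ℚ
  open import Data.Rational.Solver using (module +-*-Solver)
  import Data.Nat.Coprimality as Coprime
  open import Relation.Binary.Definitions using (tri<; tri≈; tri>)
  open import Relation.Binary.PropositionalEquality using (_≡_; refl; sym; trans; cong; cong₂)

  toℚ : ℤ → ℚ
  toℚ z = z / 1

  toℚ-mkℚ : ∀ z → toℚ z ≡ mkℚ z 0 (Coprime.sym (Coprime.1-coprimeTo ℤ.∣ z ∣))
  toℚ-mkℚ z = ℚ.↥p/↧p≡p (mkℚ z 0 (Coprime.sym (Coprime.1-coprimeTo ℤ.∣ z ∣)))

  toℚ-+ : ∀ a b → toℚ (a ℤ.+ b) ≡ toℚ a + toℚ b
  toℚ-+ a b rewrite toℚ-mkℚ a | toℚ-mkℚ b = ℚ./-cong (cong₂ ℤ._+_ (sym (ℤ.*-identityʳ a)) (sym (ℤ.*-identityʳ b))) refl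

  toℚ-* : ∀ a b → toℚ (a ℤ.* b) ≡ toℚ a * toℚ b
  toℚ-* a b rewrite toℚ-mkℚ a | toℚ-mkℚ b = refl

  toℚ-neg : ∀ a → toℚ (ℤ.- a) ≡ - toℚ a
  toℚ-neg a rewrite toℚ-mkℚ a | toℚ-mkℚ (ℤ.- a) with a
  ... | + zero = refl
  ... | + suc n = refl
  ... | -[1+ n ] = refl

  scaledUcoef : ℕ → ℕ → ℚ
  scaledUcoef m j = toℚ (Ucoef m j) * (½ ^ℚ j)

  scaledUcoef-recurrence : ∀ m j → scaledUcoef (suc (suc m)) (suc j) + scaledUcoef m (suc j) ≡ scaledUcoef (suc m) j
  scaledUcoef-recurrence m j
    rewrite toℚ-+ (+ 2 ℤ.* Ucoef (suc m) j) (ℤ.- Ucoef m (suc j)) | toℚ-* (+ 2) (Ucoef (suc m) j) | toℚ-neg (Ucoef m (suc j)) =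
    trans (solve 5 (λ t s u₁ u₀ h → ((t :* u₁) :+ (:- u₀)) :* (s :* h) :+ (u₀ :* (s :* h)) := (t :* s) :* (u₁ :* h)) refl
                   (toℚ (+ 2)) ½ (toℚ (Ucoef (suc m) j)) (toℚ (Ucoef m (suc j))) (½ ^ℚ j))
          (ℚ.*-identityˡ _)
    where open +-*-Solver

  scaledUcoef-recurrence₀ : ∀ m → scaledUcoef (suc (suc m)) 0 + scaledUcoef m 0 ≡ 0ℚ
  scaledUcoef-recurrence₀ m rewrite toℚ-neg (Ucoef m 0) =
    solve 1 (λ u → (:- u) :* con 1ℚ :+ u :* con 1ℚ := con 0ℚ) refl (toℚ (Ucoef m 0))
    where open +-*-Solver

  Ucoef-degree : ∀ m j → m ≤ j → Ucoef m j ≡ ℤ.0ℤ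
  Ucoef-degree zero j m≤j = refl
  Ucoef-degree (suc zero) (suc j) m≤j = refl
  Ucoef-degree (suc (suc m)) (suc j) (s≤s m≤j)
    rewrite Ucoef-degree (suc m) j m≤j | Ucoef-degree m (suc j) (ℕ.m≤n⇒m≤1+n (ℕ.≤-trans (ℕ.n≤1+n m) m≤j)) = refl

  scaledUcoef-degree : ∀ m j → m ≤ j → scaledUcoef m j ≡ 0ℚ
  scaledUcoef-degree m j m≤j rewrite Ucoef-degree m j m≤j = ℚ.*-zeroˡ (½ ^ℚ j)

  xPowU-recurrence : ∀ m → xPowU (suc m) (suc (suc m)) ⊕ xPowU (suc m) m ≈ₛ xPowU m (suc m)
  xPowU-recurrence m i with ℕ.<-cmp i (suc m)
  ... | tri< i<1+m _ _ rewrite ≤ᵇ-true {i} {suc m} (ℕ.<⇒≤ i<1+m) | ≤ᵇ-true {i} {m} (ℕ.≤-pred i<1+m)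
       | ℕ.+-∸-assoc 1 (ℕ.≤-pred i<1+m) = scaledUcoef-recurrence m (m ∸ i)
  ... | tri≈ _ refl _ rewrite ≤ᵇ-true {suc m} {suc m} ℕ.≤-refl | ≤ᵇ-false {suc m} {m} ℕ.≤-refl | ℕ.n∸n≡0 m = scaledUcoef-recurrence₀ m
  ... | tri> _ _ 1+m<i rewrite ≤ᵇ-false {i} {suc m} 1+m<i | ≤ᵇ-false {i} {m} (ℕ.<-trans ℕ.≤-refl 1+m<i) = refl

  xPowU-shift : ∀ N m → m ≤ suc N → xPowU (suc (suc N)) m ≈ₛ mono 2 ⊛ xPowU N m
  xPowU-shift N m m≤1+N zero = trans (scaledUcoef-degree m (suc (suc N)) (ℕ.m≤n⇒m≤1+n m≤1+N)) (sym (mono-⊛-< 2 0 (xPowU N m) (s≤s z≤n)))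
  xPowU-shift N m m≤1+N (suc zero) = trans (scaledUcoef-degree m (suc N) m≤1+N) (sym (mono-⊛-< 2 1 (xPowU N m) (s≤s (s≤s z≤n))))
  xPowU-shift N m m≤1+N (suc (suc i)) =
    trans (cong (λ b → if b then scaledUcoef m (N ∸ i) else 0ℚ) (trans (≤ᵇ-suc (suc i) (suc N)) (≤ᵇ-suc i N)))
          (sym (mono-⊛-+ 2 i (xPowU N m)))
    where
    ≤ᵇ-suc : ∀ i N → (suc i ≤ᵇ suc N) ≡ (i ≤ᵇ N)
    ≤ᵇ-suc zero N = refl
    ≤ᵇ-suc (suc i) N = refl

  P : ℕ → Series
  P m = xPowU (m ∸ 1) m

  P-0 : P 0 ≈ₛ 0ₛ
  P-0 zero = refl
  P-0 (suc i) = refl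

  P-1 : P 1 ≈ₛ 1ₛ
  P-1 zero = refl
  P-1 (suc i) = refl

  xPowU-lower : ∀ m → xPowU (suc m) m ≈ₛ mono 2 ⊛ P m
  xPowU-lower zero i = trans (vanishes i) (sym (trans (⊛-cong {mono 2} {mono 2} {P 0} {0ₛ} (λ _ → refl) P-0 i)
                                                      (trans (⊛-comm (mono 2) 0ₛ i) (⊛-zeroˡ (mono 2) i))))
    where
    vanishes : ∀ i → xPowU 1 0 i ≡ 0ℚ
    vanishes zero = refl
    vanishes (suc zero) = refl
    vanishes (suc (suc i)) = refl
  xPowU-lower (suc m) = xPowU-shift m (suc m) ℕ.≤-refl

  P-recurrence : ∀ m → P (suc (suc m)) ⊕ mono 2 ⊛ P m ≈ₛ P (suc m)
  P-recurrence m i = trans (cong (λ t → P (suc (suc m)) i + t) (sym (xPowU-lower m i))) (xPowU-recurrence m i)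

  P-constant : ∀ m → P (suc m) 0 ≡ 1ℚ
  P-constant zero = refl
  P-constant (suc m) = begin
    P (suc (suc m)) 0                           ≡⟨ sym (ℚ.+-identityʳ _) ⟩
    P (suc (suc m)) 0 + 0ℚ                      ≡⟨ cong (λ t → P (suc (suc m)) 0 + t) (sym (mono-⊛-< 2 0 (P m) (s≤s z≤n))) ⟩
    P (suc (suc m)) 0 + (mono 2 ⊛ P m) 0        ≡⟨ P-recurrence m 0 ⟩
    P (suc m) 0                                 ≡⟨ P-constant m ⟩
    1ℚ                                          ∎
    where open Relation.Binary.PropositionalEquality.≡-Reasoning

module GeneratingFunctions where

  open import Defs
  open PowerSeries
  open Chebyshev using (P; P-0; P-1; P-recurrence; P-constant)
  open import Data.Nat as ℕ using (ℕ; zero; suc)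
  import Data.Rational as ℚ
  import Data.Nat.Properties as ℕ
  open import Data.Product using (_×_; _,_; proj₁; proj₂)
  open import Algebra.Bundles using (CommutativeSemiring)
  import Algebra.Solver.Ring.NaturalCoefficients.Default as Solver
  open import Relation.Binary.PropositionalEquality using (refl; sym; trans; cong)

  open CommutativeSemiring series-commutativeSemiring
    using (setoid; *-congˡ; *-congʳ; +-congˡ; +-congʳ; *-cong; +-cong; *-assoc; zeroˡ; zeroʳ; +-identityʳ; +-identityˡ; *-identityˡ)
    renaming (refl to ≈-refl; sym to ≈-sym; trans to ≈-trans)
  open Solver series-commutativeSemiring using (solve; _:=_; _:+_; _:*_)
  open import Relation.Binary.Reasoning.Setoid setoid

  mono-+ₛ : ∀ a b → mono (a ℕ.+ b) ≈ₛ mono a *ₛ mono b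
  mono-+ₛ a b n = trans (mono-+ a b n) (sym (*ₛ≈⊛ (mono a) (mono b) n))

  x² : mono 2 ≈ₛ x *ₛ x
  x² = mono-+ₛ 1 1

  x²-mono : ∀ i → x *ₛ (x *ₛ mono (2 ℕ.* i)) ≈ₛ mono (2 ℕ.* suc i)
  x²-mono i = begin
    x *ₛ (x *ₛ mono (2 ℕ.* i)) ≈⟨ *-congˡ (≈-sym (mono-+ₛ 1 (2 ℕ.* i))) ⟩
    x *ₛ mono (1 ℕ.+ 2 ℕ.* i) ≈⟨ ≈-sym (mono-+ₛ 1 (1 ℕ.+ 2 ℕ.* i)) ⟩
    mono (2 ℕ.+ 2 ℕ.* i)     ≈⟨ (λ n → cong (λ t → mono t n) (sym (ℕ.*-suc 2 i))) ⟩
    mono (2 ℕ.* suc i)       ∎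

  P-recurrenceₛ : ∀ m → P (suc (suc m)) +ₛ mono 2 *ₛ P m ≈ₛ P (suc m)
  P-recurrenceₛ m n = trans (+ₛ≈⊕ _ _ n) (trans (cong (P (suc (suc m)) n ℚ.+_) (*ₛ≈⊛ (mono 2) (P m) n)) (P-recurrence m n))

  P-recurrence-x : ∀ i → P (suc (suc i)) +ₛ x *ₛ (x *ₛ P i) ≈ₛ P (suc i)
  P-recurrence-x i = begin
    P (suc (suc i)) +ₛ x *ₛ (x *ₛ P i) ≈⟨ +-congˡ (≈-sym (*-assoc x x (P i))) ⟩
    P (suc (suc i)) +ₛ (x *ₛ x) *ₛ P i ≈⟨ +-congˡ (*-congʳ (≈-sym x²)) ⟩
    P (suc (suc i)) +ₛ mono 2 *ₛ P i  ≈⟨ P-recurrenceₛ i ⟩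
    P (suc i)                       ∎

  module Solution (UD UU DD DU E F G : ℕ → Series)
    (UD-suc : ∀ k → UD (suc k) ≈ₛ x *ₛ (E k *ₛ E (suc k)))
    (UU-suc : ∀ k → UU (suc k) ≈ₛ x *ₛ (E k *ₛ G (suc k)))
    (DD-suc : ∀ k → DD (suc k) ≈ₛ x *ₛ (F k *ₛ E (suc k)))
    (DU-suc : ∀ k → DU (suc (suc k)) +ₛ x ≈ₛ x *ₛ (F (suc k) *ₛ G (suc (suc k))))
    (E-0 : E 0 ≈ₛ 0ₛ) (F-0 : F 0 ≈ₛ 0ₛ)
    (E-1 : E 1 ≈ₛ UD 1)
    (E-UD : ∀ j → E (suc (suc j)) ≈ₛ x +ₛ UD (suc (suc j)))
    (F-DD : ∀ j → F (suc j) ≈ₛ 1ₛ +ₛ DD (suc j))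
    (G-UU : ∀ j → G (suc j) ≈ₛ 1ₛ +ₛ UU (suc j))
    where

    Invariant : ℕ → Set
    Invariant i = (E (suc i) *ₛ P (suc i) ≈ₛ x *ₛ P i) × (F (suc i) *ₛ P (suc i) ≈ₛ P i +ₛ mono (2 ℕ.* i))

    invariant-1 : Invariant 0
    invariant-1 = E-1·P , F-1·P
      where
      UD-1 : UD 1 ≈ₛ 0ₛ
      UD-1 = ≈-trans (UD-suc 0) (≈-trans (*-congˡ (≈-trans (*-congʳ E-0) (zeroˡ (E 1)))) (zeroʳ x))
      DD-1 : DD 1 ≈ₛ 0ₛ
      DD-1 = ≈-trans (DD-suc 0) (≈-trans (*-congˡ (≈-trans (*-congʳ F-0) (zeroˡ (E 1)))) (zeroʳ x))
      E-1·P : E 1 *ₛ P 1 ≈ₛ x *ₛ P 0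
      E-1·P = ≈-trans (*-congʳ (≈-trans E-1 UD-1)) (≈-trans (zeroˡ (P 1)) (≈-sym (≈-trans (*-congˡ P-0) (zeroʳ x))))
      F-1·P : F 1 *ₛ P 1 ≈ₛ P 0 +ₛ mono 0
      F-1·P = ≈-trans (*-cong (≈-trans (F-DD 0) (≈-trans (+-congˡ DD-1) (+-identityʳ 1ₛ))) P-1)
                      (≈-trans (*-identityˡ 1ₛ) (≈-sym (≈-trans (+-congʳ P-0) (+-identityˡ 1ₛ))))

    module Step (i : ℕ) (inv : Invariant i) where
      k : ℕ
      k = suc (suc i)
      p q r e f : Series
      p = P k
      q = P (suc i)
      r = P i
      e = E (suc i)
      f = F (suc i)

      UD·P : UD k *ₛ p ≈ₛ x *ₛ (x *ₛ (x *ₛ r))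
      UD·P = +ₛ-cancelʳ _ _ (UD k *ₛ (x *ₛ (x *ₛ r))) (begin
        (UD k *ₛ p) +ₛ (UD k *ₛ (x *ₛ (x *ₛ r)))
          ≈⟨ solve 4 (λ u p x r → (u :* p) :+ (u :* (x :* (x :* r))) := u :* (p :+ x :* (x :* r))) ≈-refl (UD k) p x r ⟩
        UD k *ₛ (p +ₛ x *ₛ (x *ₛ r))
          ≈⟨ *-congˡ (P-recurrence-x i) ⟩
        UD k *ₛ q
          ≈⟨ *-congʳ (≈-trans (UD-suc (suc i)) (*-congˡ (*-congˡ (E-UD i)))) ⟩
        (x *ₛ (e *ₛ (x +ₛ UD k))) *ₛ q
          ≈⟨ solve 4 (λ x e u q → (x :* (e :* (x :+ u))) :* q := (x :* (x :+ u)) :* (e :* q)) ≈-refl x e (UD k) q ⟩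
        (x *ₛ (x +ₛ UD k)) *ₛ (e *ₛ q)
          ≈⟨ *-congˡ (proj₁ inv) ⟩
        (x *ₛ (x +ₛ UD k)) *ₛ (x *ₛ r)
          ≈⟨ solve 3 (λ x u r → (x :* (x :+ u)) :* (x :* r) := (x :* (x :* (x :* r))) :+ (u :* (x :* (x :* r)))) ≈-refl x (UD k) r ⟩
        (x *ₛ (x *ₛ (x *ₛ r))) +ₛ (UD k *ₛ (x *ₛ (x *ₛ r))) ∎)

      UU·P : UU k *ₛ p ≈ₛ x *ₛ (x *ₛ r)
      UU·P = +ₛ-cancelʳ _ _ (UU k *ₛ (x *ₛ (x *ₛ r))) (begin
        (UU k *ₛ p) +ₛ (UU k *ₛ (x *ₛ (x *ₛ r)))
          ≈⟨ solve 4 (λ u p x r → (u :* p) :+ (u :* (x :* (x :* r))) := u :* (p :+ x :* (x :* r))) ≈-refl (UU k) p x r ⟩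
        UU k *ₛ (p +ₛ x *ₛ (x *ₛ r))
          ≈⟨ *-congˡ (P-recurrence-x i) ⟩
        UU k *ₛ q
          ≈⟨ *-congʳ (≈-trans (UU-suc (suc i)) (*-congˡ (*-congˡ (G-UU (suc i))))) ⟩
        (x *ₛ (e *ₛ (1ₛ +ₛ UU k))) *ₛ q
          ≈⟨ solve 5 (λ x e o u q → (x :* (e :* (o :+ u))) :* q := (x :* (o :+ u)) :* (e :* q)) ≈-refl x e 1ₛ (UU k) q ⟩
        (x *ₛ (1ₛ +ₛ UU k)) *ₛ (e *ₛ q)
          ≈⟨ *-congˡ (proj₁ inv) ⟩
        (x *ₛ (1ₛ +ₛ UU k)) *ₛ (x *ₛ r)
          ≈⟨ solve 4 (λ x o u r → (x :* (o :+ u)) :* (x :* r) := (o :* (x :* (x :* r))) :+ (u :* (x :* (x :* r)))) ≈-refl x 1ₛ (UU k) r ⟩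
        (1ₛ *ₛ (x *ₛ (x *ₛ r))) +ₛ (UU k *ₛ (x *ₛ (x *ₛ r)))
          ≈⟨ +-congʳ (*-identityˡ _) ⟩
        (x *ₛ (x *ₛ r)) +ₛ (UU k *ₛ (x *ₛ (x *ₛ r))) ∎)

      E·P : E k *ₛ p ≈ₛ x *ₛ q
      E·P = begin
        E k *ₛ p                         ≈⟨ *-congʳ (E-UD i) ⟩
        (x +ₛ UD k) *ₛ p                  ≈⟨ solve 3 (λ x u p → (x :+ u) :* p := x :* p :+ u :* p) ≈-refl x (UD k) p ⟩
        x *ₛ p +ₛ UD k *ₛ p                ≈⟨ +-congˡ UD·P ⟩
        x *ₛ p +ₛ x *ₛ (x *ₛ (x *ₛ r))       ≈⟨ solve 3 (λ x p r → x :* p :+ x :* (x :* (x :* r)) := x :* (p :+ x :* (x :* r))) ≈-refl x p r ⟩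
        x *ₛ (p +ₛ x *ₛ (x *ₛ r))           ≈⟨ *-congˡ (P-recurrence-x i) ⟩
        x *ₛ q                           ∎

      DD·P : DD k *ₛ p ≈ₛ x *ₛ (x *ₛ (r +ₛ mono (2 ℕ.* i)))
      DD·P = *ₛ-cancelʳ _ _ q (P-constant i) (begin
        (DD k *ₛ p) *ₛ q                      ≈⟨ *-congʳ (*-congʳ (DD-suc (suc i))) ⟩
        ((x *ₛ (f *ₛ E k)) *ₛ p) *ₛ q
          ≈⟨ solve 5 (λ x f ek p q → ((x :* (f :* ek)) :* p) :* q := x :* ((f :* q) :* (ek :* p))) ≈-refl x f (E k) p q ⟩
        x *ₛ ((f *ₛ q) *ₛ (E k *ₛ p))           ≈⟨ *-congˡ (*-cong (proj₂ inv) E·P) ⟩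
        x *ₛ ((r +ₛ mono (2 ℕ.* i)) *ₛ (x *ₛ q))
          ≈⟨ solve 3 (λ x s q → x :* (s :* (x :* q)) := (x :* (x :* s)) :* q) ≈-refl x (r +ₛ mono (2 ℕ.* i)) q ⟩
        (x *ₛ (x *ₛ (r +ₛ mono (2 ℕ.* i)))) *ₛ q ∎)

      G·P : G k *ₛ p ≈ₛ q
      G·P = begin
        G k *ₛ p                  ≈⟨ *-congʳ (G-UU (suc i)) ⟩
        (1ₛ +ₛ UU k) *ₛ p          ≈⟨ solve 3 (λ o u p → (o :+ u) :* p := o :* p :+ u :* p) ≈-refl 1ₛ (UU k) p ⟩
        1ₛ *ₛ p +ₛ UU k *ₛ p        ≈⟨ +-cong (*-identityˡ p) UU·P ⟩
        p +ₛ x *ₛ (x *ₛ r)          ≈⟨ P-recurrence-x i ⟩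
        q                        ∎

      F·P : F k *ₛ p ≈ₛ q +ₛ mono (2 ℕ.* suc i)
      F·P = begin
        F k *ₛ p                  ≈⟨ *-congʳ (F-DD (suc i)) ⟩
        (1ₛ +ₛ DD k) *ₛ p          ≈⟨ solve 3 (λ o u p → (o :+ u) :* p := o :* p :+ u :* p) ≈-refl 1ₛ (DD k) p ⟩
        1ₛ *ₛ p +ₛ DD k *ₛ p        ≈⟨ +-cong (*-identityˡ p) DD·P ⟩
        p +ₛ x *ₛ (x *ₛ (r +ₛ mono (2 ℕ.* i)))
          ≈⟨ solve 4 (λ p x r m → p :+ x :* (x :* (r :+ m)) := (p :+ x :* (x :* r)) :+ x :* (x :* m)) ≈-refl p x r (mono (2 ℕ.* i)) ⟩
        (p +ₛ x *ₛ (x *ₛ r)) +ₛ x *ₛ (x *ₛ mono (2 ℕ.* i)) ≈⟨ +-cong (P-recurrence-x i) (x²-mono i) ⟩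
        q +ₛ mono (2 ℕ.* suc i)   ∎

      DU·P : (x *ₛ (DU k +ₛ x)) *ₛ p ≈ₛ x *ₛ (x *ₛ (r +ₛ mono (2 ℕ.* i)))
      DU·P = begin
        (x *ₛ (DU k +ₛ x)) *ₛ p                ≈⟨ *-congʳ (*-congˡ (DU-suc i)) ⟩
        (x *ₛ (x *ₛ (f *ₛ G k))) *ₛ p
          ≈⟨ solve 4 (λ x f g p → (x :* (x :* (f :* g))) :* p := x :* (x :* (f :* (g :* p)))) ≈-refl x f (G k) p ⟩
        x *ₛ (x *ₛ (f *ₛ (G k *ₛ p)))           ≈⟨ *-congˡ (*-congˡ (*-congˡ G·P)) ⟩
        x *ₛ (x *ₛ (f *ₛ q))                   ≈⟨ *-congˡ (*-congˡ (proj₂ inv)) ⟩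
        x *ₛ (x *ₛ (r +ₛ mono (2 ℕ.* i)))      ∎

      next : Invariant (suc i)
      next = E·P , F·P

    invariant : ∀ i → Invariant i
    invariant zero = invariant-1
    invariant (suc i) = Step.next i (invariant i)

    module _ (i : ℕ) where
      open Step i (invariant i)

      x²P : x *ₛ (x *ₛ r) ≈ₛ mono 2 *ₛ r
      x²P = ≈-trans (≈-sym (*-assoc x x r)) (*-congʳ (≈-sym x²))

      x²-shift : x *ₛ (x *ₛ (r +ₛ mono (2 ℕ.* i))) ≈ₛ mono (2 ℕ.* suc i) +ₛ mono 2 *ₛ r
      x²-shift = begin
        x *ₛ (x *ₛ (r +ₛ mono (2 ℕ.* i)))
          ≈⟨ solve 3 (λ x r m → x :* (x :* (r :+ m)) := x :* (x :* m) :+ x :* (x :* r)) ≈-refl x r (mono (2 ℕ.* i)) ⟩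
        x *ₛ (x *ₛ mono (2 ℕ.* i)) +ₛ x *ₛ (x *ₛ r) ≈⟨ +-cong (x²-mono i) x²P ⟩
        mono (2 ℕ.* suc i) +ₛ mono 2 *ₛ r ∎

      UD-identity : UD k *ₛ P k ≈ₛ x *ₛ (mono 2 *ₛ P i)
      UD-identity = ≈-trans UD·P (*-congˡ x²P)

      DD-identity : DD k *ₛ P k ≈ₛ mono (2 ℕ.* suc i) +ₛ mono 2 *ₛ P i
      DD-identity = ≈-trans DD·P x²-shift

      UU-identity : UU k *ₛ P k ≈ₛ mono 2 *ₛ P i
      UU-identity = ≈-trans UU·P x²P

      DU-identity : (x *ₛ (DU k +ₛ x)) *ₛ P k ≈ₛ mono (2 ℕ.* suc i) +ₛ mono 2 *ₛ P i
      DU-identity = ≈-trans DU·P x²-shift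

module SeriesOfCounts where

  open import Defs
  open PowerSeries
  open Chebyshev using (toℚ; toℚ-+; toℚ-*)
  open Alternation using (oddUp; evenUp; evenDown)
  open import Data.Bool using (_∧_)
  open import Data.List using (List; length)
  open MaxDecomposition using (count132; sumℕ)
  open Recurrences
  open GeneratingFunctions using (module Solution)
  open import Data.Nat as ℕ using (ℕ; zero; suc; _∸_; s≤s; z≤n)
  open import Data.Nat.Properties using (0≢1+n; 1+n≢0; suc-injective)
  open import Data.Integer using (+_)
  import Data.Integer.Properties as ℤ
  open import Data.Rational using (0ℚ; _+_; _*_)
  import Data.Rational.Properties as ℚ
  open import Relation.Binary.PropositionalEquality using (_≡_; _≢_; refl; sym; trans; cong)

  toℚ-sumℕ : ∀ m (f : ℕ → ℕ) → toℚ (+ sumℕ m f) ≡ sumTo m (λ a → toℚ (+ f a))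
  toℚ-sumℕ zero f = refl
  toℚ-sumℕ (suc m) f = trans (trans (cong toℚ (ℤ.pos-+ (sumℕ m f) (f (suc m)))) (toℚ-+ (+ sumℕ m f) (+ f (suc m))))
                             (cong (_+ toℚ (+ f (suc m))) (toℚ-sumℕ m f))

  x*ₛ-0 : ∀ h → (x *ₛ h) 0 ≡ 0ℚ
  x*ₛ-0 h = trans (*ₛ≈⊛ x h 0) (mono-⊛-< 1 0 h (s≤s z≤n))

  x*ₛ-suc : ∀ h n → (x *ₛ h) (suc n) ≡ h n
  x*ₛ-suc h n = trans (*ₛ≈⊛ x h (suc n)) (mono-⊛-+ 1 n h)

  fromCounts-convolution : ∀ (c₁ c₂ : ℕ → ℕ) m →
    fromCounts (λ m → sumℕ m (λ a → c₁ a ℕ.* c₂ (m ∸ a))) m ≡ (fromCounts c₁ *ₛ fromCounts c₂) m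
  fromCounts-convolution c₁ c₂ m =
    trans (toℚ-sumℕ m _)
          (trans (sumTo-cong′ m (λ a → trans (cong toℚ (ℤ.pos-* (c₁ a) (c₂ (m ∸ a)))) (toℚ-* (+ c₁ a) (+ c₂ (m ∸ a)))))
                                (sym (*ₛ≈⊛ (fromCounts c₁) (fromCounts c₂) m)))

  fromCounts-shifted-convolution : ∀ (c c₁ c₂ : ℕ → ℕ) → c 0 ≡ 0 →
    (∀ m → c (suc m) ≡ sumℕ m (λ a → c₁ a ℕ.* c₂ (m ∸ a))) →
    fromCounts c ≈ₛ x *ₛ (fromCounts c₁ *ₛ fromCounts c₂)
  fromCounts-shifted-convolution c c₁ c₂ c₀ c-suc zero = trans (cong (λ t → toℚ (+ t)) c₀) (sym (x*ₛ-0 _))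
  fromCounts-shifted-convolution c c₁ c₂ c₀ c-suc (suc m) =
    trans (cong (λ t → toℚ (+ t)) (c-suc m)) (trans (fromCounts-convolution c₁ c₂ m) (sym (x*ₛ-suc _ m)))

  UD UU DD DU E F G : ℕ → Series
  UD k = fromCounts (ud k)
  UU k = fromCounts (uu k)
  DD k = fromCounts (dd k)
  DU k = fromCounts (du k)
  E k = fromCounts (count132 (avoiding k oddUp))
  F k = fromCounts (count132 (avoiding k evenDown))
  G k = fromCounts (count132 (avoiding k evenUp))

  private
    counts-agree : ∀ j cls cls′ m → (∀ w → length w ≡ m → cls w ≡ cls′ w) →
      fromCounts (count132 (avoiding j cls)) m ≡ fromCounts (countAv cls′ j) m
    counts-agree j cls cls′ m cls≡cls′ = cong (λ t → toℚ (+ t))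
      (trans (count132-cong _ _ m (λ w len → cong (_∧ avoids (inc j) w) (cls≡cls′ w len))) (sym (countAv≡count132 cls′ j m)))

    plus-zeroˡ : ∀ (f g : Series) m → f m ≡ 0ℚ → (f +ₛ g) m ≡ g m
    plus-zeroˡ f g m f≡0 = trans (+ₛ≈⊕ f g m) (trans (cong (_+ g m) f≡0) (ℚ.+-identityˡ (g m)))

  UD-suc : ∀ k → UD (suc k) ≈ₛ x *ₛ (E k *ₛ E (suc k))
  UD-suc k = fromCounts-shifted-convolution (ud (suc k)) (count132 (avoiding k oddUp)) (count132 (avoiding (suc k) oddUp)) refl
    (λ m → trans (countAv≡count132 isUpDown (suc k) (suc m)) (recurrence-upDown k m))

  UU-suc : ∀ k → UU (suc k) ≈ₛ x *ₛ (E k *ₛ G (suc k))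
  UU-suc k = fromCounts-shifted-convolution (uu (suc k)) (count132 (avoiding k oddUp)) (count132 (avoiding (suc k) evenUp)) refl
    (λ m → trans (countAv≡count132 isUpUp (suc k) (suc m)) (recurrence-upUp k m))

  DD-suc : ∀ k → DD (suc k) ≈ₛ x *ₛ (F k *ₛ E (suc k))
  DD-suc k = fromCounts-shifted-convolution (dd (suc k)) (count132 (avoiding k evenDown)) (count132 (avoiding (suc k) oddUp)) refl
    (λ m → trans (countAv≡count132 isDownDown (suc k) (suc m)) (recurrence-downDown k m))

  -- The recurrence for down-up permutations fails at length one, where the glued word is the single letter 1.
  DU-suc : ∀ k → DU (suc (suc k)) +ₛ x ≈ₛ x *ₛ (F (suc k) *ₛ G (suc (suc k)))
  DU-suc k zero = trans (+ₛ≈⊕ _ x 0) (sym (x*ₛ-0 _))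
  DU-suc k (suc zero) = trans (+ₛ≈⊕ _ x 1) (sym (trans (x*ₛ-suc _ 0) (*ₛ≈⊛ (F (suc k)) (G (suc (suc k))) 0)))
  DU-suc k (suc (suc m)) = trans (+ₛ≈⊕ _ x (suc (suc m))) (trans (ℚ.+-identityʳ _)
    (trans (cong (λ t → toℚ (+ t)) (trans (countAv≡count132 isDownUp (suc (suc k)) (suc (suc m))) (recurrence-downUp (suc k) (suc m) (s≤s z≤n))))
           (trans (fromCounts-convolution (count132 (avoiding (suc k) evenDown)) (count132 (avoiding (suc (suc k)) evenUp)) (suc m)) (sym (x*ₛ-suc _ (suc m))))))

  E-0 : E 0 ≈ₛ 0ₛ
  E-0 m = cong (λ t → toℚ (+ t)) (count132-avoiding-0 oddUp m)

  F-0 : F 0 ≈ₛ 0ₛ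
  F-0 m = cong (λ t → toℚ (+ t)) (count132-avoiding-0 evenDown m)

  private
    ≢1-0 : ∀ {w : List ℕ} → length w ≡ 0 → length w ≢ 1
    ≢1-0 len len≡1 = 0≢1+n (trans (sym len) len≡1)

    ≢1-2+ : ∀ {w : List ℕ} m → length w ≡ suc (suc m) → length w ≢ 1
    ≢1-2+ m len len≡1 = 1+n≢0 (suc-injective (trans (sym len) len≡1))

    ≢0-1+ : ∀ {w : List ℕ} m → length w ≡ suc m → length w ≢ 0
    ≢0-1+ m len len≡0 = 1+n≢0 (trans (sym len) len≡0)

  E-1 : E 1 ≈ₛ UD 1
  E-1 zero = counts-agree 1 oddUp isUpDown 0 (λ w len → oddUp≡isUpDown w (≢1-0 {w} len))
  E-1 (suc zero) = refl
  E-1 (suc (suc m)) = counts-agree 1 oddUp isUpDown (suc (suc m)) (λ w len → oddUp≡isUpDown w (≢1-2+ {w} m len))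

  E-UD : ∀ j → E (suc (suc j)) ≈ₛ x +ₛ UD (suc (suc j))
  E-UD j zero = trans (counts-agree (suc (suc j)) oddUp isUpDown 0 (λ w len → oddUp≡isUpDown w (≢1-0 {w} len)))
                      (sym (plus-zeroˡ x _ 0 refl))
  E-UD j (suc zero) = sym (+ₛ≈⊕ x (UD (suc (suc j))) 1)
  E-UD j (suc (suc m)) = trans (counts-agree (suc (suc j)) oddUp isUpDown (suc (suc m)) (λ w len → oddUp≡isUpDown w (≢1-2+ {w} m len)))
                               (sym (plus-zeroˡ x _ (suc (suc m)) refl))

  F-DD : ∀ j → F (suc j) ≈ₛ 1ₛ +ₛ DD (suc j)
  F-DD j zero = sym (+ₛ≈⊕ 1ₛ (DD (suc j)) 0)
  F-DD j (suc m) = trans (counts-agree (suc j) evenDown isDownDown (suc m) (λ w len → evenDown≡isDownDown w (≢0-1+ {w} m len)))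
                         (sym (plus-zeroˡ 1ₛ _ (suc m) refl))

  G-UU : ∀ j → G (suc j) ≈ₛ 1ₛ +ₛ UU (suc j)
  G-UU j zero = sym (+ₛ≈⊕ 1ₛ (UU (suc j)) 0)
  G-UU j (suc m) = trans (counts-agree (suc j) evenUp isUpUp (suc m) (λ w len → evenUp≡isUpUp w (≢0-1+ {w} m len)))
                         (sym (plus-zeroˡ 1ₛ _ (suc m) refl))

  open Solution UD UU DD DU E F G UD-suc UU-suc DD-suc DU-suc E-0 F-0 E-1 E-UD F-DD G-UU public

open import Defs
open import Data.Nat using (ℕ; suc; _≤_; _∸_; _*_; s≤s; z≤n)
open import Data.Product using (_×_; _,_)
open import Data.Rational using (_+_)
open import Relation.Binary.PropositionalEquality using (refl; sym; trans; cong)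
open PowerSeries
open Chebyshev using (P; xPowU-lower)
open SeriesOfCounts

⊛-from-*ₛ : ∀ f g {h} → f *ₛ g ≈ₛ h → f ⊛ g ≈ₛ h
⊛-from-*ₛ f g e n = trans (sym (*ₛ≈⊛ f g n)) (e n)

x²P≈xPowU : ∀ i → mono 2 *ₛ P i ≈ₛ xPowU (suc i) i
x²P≈xPowU i n = trans (*ₛ≈⊛ (mono 2) (P i) n) (sym (xPowU-lower i n))

theorem2p4 : (k : ℕ) → 2 ≤ k →
  -- (1) UD(x) · x^{k-1}U_{k-1} = x · x^{k-1}U_{k-3}
  (fromCounts (ud k) ⊛ xPowU (k ∸ 1) k ≈ₛ mono 1 ⊛ xPowU (k ∸ 1) (k ∸ 2))
  -- (2) DD(x) · x^{k-1}U_{k-1} = x^{2(k-1)} + x^{k-1}U_{k-3}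
  × (fromCounts (dd k) ⊛ xPowU (k ∸ 1) k ≈ₛ mono (2 * (k ∸ 1)) ⊕ xPowU (k ∸ 1) (k ∸ 2))
  -- (3) UU(x) · x^{k-1}U_{k-1} = x^{k-1}U_{k-3}
  × (fromCounts (uu k) ⊛ xPowU (k ∸ 1) k ≈ₛ xPowU (k ∸ 1) (k ∸ 2))
  -- (4) x (DU(x) + x) · x^{k-1}U_{k-1} = x^{2(k-1)} + x^{k-1}U_{k-3}
  × (mono 1 ⊛ (fromCounts (du k) ⊕ mono 1) ⊛ xPowU (k ∸ 1) k ≈ₛ mono (2 * (k ∸ 1)) ⊕ xPowU (k ∸ 1) (k ∸ 2))
theorem2p4 (suc (suc i)) (s≤s (s≤s z≤n)) =
    ⊛-from-*ₛ (UD k) (P k) (λ n → trans (UD-identity i n)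
      (trans (*ₛ≈⊛ x _ n) (⊛-cong {x} {x} {mono 2 *ₛ P i} {xPowU (suc i) i} (λ _ → refl) (x²P≈xPowU i) n)))
  , ⊛-from-*ₛ (DD k) (P k) (λ n → trans (DD-identity i n) (x²-shifted n))
  , ⊛-from-*ₛ (UU k) (P k) (λ n → trans (UU-identity i n) (x²P≈xPowU i n))
  , (λ n → trans (⊛-cong {x ⊛ (DU k ⊕ x)} {x *ₛ (DU k +ₛ x)} {P k} {P k} x⊛[DU⊕x] (λ _ → refl) n)
                 (⊛-from-*ₛ (x *ₛ (DU k +ₛ x)) (P k) (λ n → trans (DU-identity i n) (x²-shifted n)) n))
  where
  k : ℕ
  k = suc (suc i)
  x²-shifted : mono (2 * suc i) +ₛ mono 2 *ₛ P i ≈ₛ mono (2 * suc i) ⊕ xPowU (suc i) i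
  x²-shifted n = trans (+ₛ≈⊕ _ _ n) (cong (mono (2 * suc i) n +_) (x²P≈xPowU i n))
  x⊛[DU⊕x] : x ⊛ (DU k ⊕ x) ≈ₛ x *ₛ (DU k +ₛ x)
  x⊛[DU⊕x] n = trans (⊛-cong {x} {x} {DU k ⊕ x} {DU k +ₛ x} (λ _ → refl) (λ m → sym (+ₛ≈⊕ (DU k) x m)) n)
                     (sym (*ₛ≈⊛ x (DU k +ₛ x) n))
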